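{- Let $p\geq 3$ be a prime and let $1\leq r\leq p-1$. Then for all integers $\alpha\geq 0$ and $m\geq 0$, $$\sum_{n\geq 0}\overline a_{8m+3}(8\cdot p^{2\alpha}n+p^{2\alpha})q^n\equiv 2\psi(q)\pmod{16},$$ and for all integers $n\geq 0$, $$\overline a_{8m+3}\big(8\cdot p^{2\alpha+1}(pn+r)+p^{2\alpha+2}\big)\equiv 0\pmod{16}.$$
   Context: For $|q|<1$ and a positive integer $h$, write $f_h=(q^h;q^h)_\infty=\prod_{k\geq 1}(1-q^{hk})$. For a positive integer $c$, the generalized overcubic partition function $\overline a_c(n)$ is defined by the generating function $\sum_{n\geq 0}\overline a_c(n)q^n=\dfrac{f_4^{c-1}}{f_1^2f_2^{2c-3}}$. Ramanujan's theta function is $\psi(q)=\sum_{\nu\geq 0}q^{\nu(\nu+1)/2}=\dfrac{f_2^2}{f_1}$. A congruence between power series in $q$ modulo $16$ means coefficientwise congruence of integer coefficients. -}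

module Defs where

open import Data.Nat as ℕ using (ℕ; zero; suc; _∸_)
open import Data.Nat.Divisibility using (_∣?_)
open import Data.Integer as ℤ using (ℤ; +_)
open import Relation.Nullary using (Dec; does)
open import Data.Bool using (if_then_else_)

-- Formal power series in q with integer coefficients: n ↦ coefficient of q^n.
Series : Set
Series = ℕ → ℤ

[_] : {P : Set} → Dec P → ℤ
[ d ] = if does d then ℤ.+ 1 else ℤ.+ 0

sumTo : ℕ → (ℕ → ℤ) → ℤ
sumTo zero f = f zero
sumTo (suc n) f = sumTo n f ℤ.+ f (suc n)

mul : Series → Series → Series
mul a b n = sumTo n (λ i → a i ℤ.* b (n ∸ i))

one : Series
one n = [ n ℕ.≟ 0 ]

pow : Series → ℕ → Series
pow a zero = one
pow a (suc k) = mul a (pow a k)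

prodTo : ℕ → (ℕ → Series) → Series
prodTo zero F = one
prodTo (suc K) F = mul (F (suc K)) (prodTo K F)

oneMinus : ℕ → Series
oneMinus d n = [ n ℕ.≟ 0 ] ℤ.- [ n ℕ.≟ d ]

-- the series 1/(1 - q^d) = Σ_{j ≥ 0} q^{dj}   (used for d ≥ 1)
geom : ℕ → Series
geom d n = [ d ∣? n ]

-- f_h = ∏_{k ≥ 1} (1 - q^{hk}); for h ≥ 1 the coefficient of q^n only
-- depends on the factors with k ≤ n.
f : ℕ → Series
f h n = prodTo n (λ k → oneMinus (h ℕ.* k)) n

-- 1/f_h = ∏_{k ≥ 1} 1/(1 - q^{hk})   (h ≥ 1)
fInv : ℕ → Series
fInv h n = prodTo n (λ k → geom (h ℕ.* k)) n

-- generating function f_4^{c-1} / (f_1^2 f_2^{2c-3}) for c ≥ 1, c = suc c'.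
-- For c = 1 the factor f_2^{-(2c-3)} is f_2; for c = suc (suc c'') it is
-- (1/f_2)^{2c''+1}.
abarSeries : ℕ → Series
abarSeries zero = λ _ → ℤ.+ 0   -- c = 0 is not in the range c ≥ 1; never used
abarSeries (suc c') = mul (pow (f 4) c') (mul (pow (fInv 1) 2) (third c'))
  where
  third : ℕ → Series
  third zero = f 2
  third (suc c'') = pow (fInv 2) (2 ℕ.* c'' ℕ.+ 1)

abar : ℕ → ℕ → ℤ
abar c n = abarSeries c n

-- ψ(q) = Σ_{ν ≥ 0} q^{ν(ν+1)/2}; coefficient of q^n counts ν with ν(ν+1) = 2n
-- (necessarily ν ≤ n).
psi : Series
psi n = sumTo n (λ ν → [ ν ℕ.* suc ν ℕ.≟ 2 ℕ.* n ])

_≡_[mod_] : ℤ → ℤ → ℕ → Set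
a ≡ b [mod k ] = (+ k) ∣ (a ℤ.- b)
  where open import Data.Integer.Divisibility using (_∣_)

{-# OPTIONS --safe #-}
-- Jacobi's triple product, in the form φ(q) f₁² f₄² = f₂⁵, turns the generating function
-- f₄² / (f₁² f₂³) of ā₃ into φ(q) · f₄⁴/f₂⁸. Squaring f₂² ≡ f₄ (mod 2) repeatedly gives
-- f₄⁴/f₂⁸ ≡ 1 (mod 8) and f₄⁸/f₂¹⁶ ≡ 1 (mod 16). The second congruence is the ratio of the
-- generating functions of ā_{8m+11} and ā_{8m+3}; the first, being a series in q², shows that the
-- odd coefficients of φ(q) = 1 + 2 Σ_{j ≥ 1} q^{j²} survive modulo 16. So for odd N,
-- ā_{8m+3}(N) ≡ 2 · #{j ≥ 1 : j² = N} (mod 16). Finally p^{2α}(8n + 1) is a square exactly when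
-- 8n + 1 is, i.e. when n is triangular, which is what ψ counts, while p^{2α+1}(8(pn + r) + p) has
-- odd p-adic valuation.
--
-- The triple product is proved in the finite form c_n(j) (q²;q²)_{n+j} (q²;q²)_{n-j} = q^{j²} (q²;q²)_{2n},
-- by induction on n, and passed to the limit one coefficient at a time.
module Submission where

open import Defs
open import Data.Nat using (ℕ; _+_; _*_; _^_; _≤_; _∸_)
open import Data.Nat.Primality using (Prime)
open import Data.Integer using (+_) renaming (_*_ to _*ℤ_)
open import Data.Product using (_×_)

open import Algebra.Bundles using (CommutativeRing)
import Algebra.Properties.CommutativeSemigroup as CommSemigroupProperties
import Algebra.Solver.Ring
import Algebra.Solver.Ring.AlmostCommutativeRing as ACR
open import Data.Bool using (if_then_else_)
open import Data.Integer as ℤ using (ℤ; -_) renaming (_+_ to _+ℤ_)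
import Data.Integer.Properties as ℤP
open import Data.List using (_∷_; [])
open import Data.Maybe using (Maybe; just; nothing)
open import Data.Nat as ℕ using (zero; suc; _<_; z≤n; s≤s)
open import Data.Nat.Divisibility as ℕ∣ using (_∣_; _∣?_)
import Data.Nat.Properties as ℕP
open import Data.Nat.Primality using (euclidsLemma; prime⇒irreducible; prime⇒nonZero)
open import Data.Nat.Tactic.RingSolver using (solve; solve-∀)
open import Data.Product using (∃; _,_)
open import Data.Sum using (_⊎_; inj₁; inj₂; reduce)
open import Function using (_∘_; _$_; flip)
open import Relation.Binary.PropositionalEquality hiding ([_])
import Relation.Binary.Reasoning.Setoid
open import Relation.Binary.Definitions using (tri<; tri≈; tri>)
open import Relation.Nullary using (¬_; Dec; yes; no; does)
open import Relation.Nullary.Negation using (contradiction)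

[yes] : ∀ {P : Set} (d : Dec P) → P → [ d ] ≡ + 1
[yes] (yes _) _ = refl
[yes] (no ¬p) p = contradiction p ¬p

[no] : ∀ {P : Set} (d : Dec P) → ¬ P → [ d ] ≡ + 0
[no] (yes p) ¬p = contradiction p ¬p
[no] (no _)  _  = refl

[]-cong : ∀ {P Q : Set} (d : Dec P) (e : Dec Q) → (P → Q) → (Q → P) → [ d ] ≡ [ e ]
[]-cong d e P→Q Q→P with d | e
... | yes _ | yes _ = refl
... | yes p | no ¬q = contradiction (P→Q p) ¬q
... | no ¬p | yes q = contradiction (Q→P q) ¬p
... | no _  | no _  = refl

sumTo-cong : ∀ n {f g : ℕ → ℤ} → (∀ i → i ≤ n → f i ≡ g i) → sumTo n f ≡ sumTo n g
sumTo-cong zero    f≗g = f≗g 0 z≤n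
sumTo-cong (suc n) f≗g =
  cong₂ _+ℤ_ (sumTo-cong n (λ i i≤n → f≗g i (ℕP.m≤n⇒m≤1+n i≤n))) (f≗g (suc n) ℕP.≤-refl)

sumTo-zero : ∀ n {f : ℕ → ℤ} → (∀ i → i ≤ n → f i ≡ + 0) → sumTo n f ≡ + 0
sumTo-zero zero    f≗0 = f≗0 0 z≤n
sumTo-zero (suc n) f≗0 =
  cong₂ _+ℤ_ (sumTo-zero n (λ i i≤n → f≗0 i (ℕP.m≤n⇒m≤1+n i≤n))) (f≗0 (suc n) ℕP.≤-refl)

sumTo-+ : ∀ n (f g : ℕ → ℤ) → sumTo n (λ i → f i +ℤ g i) ≡ sumTo n f +ℤ sumTo n g
sumTo-+ zero    f g = refl
sumTo-+ (suc n) f g = trans (cong (_+ℤ (f (suc n) +ℤ g (suc n))) (sumTo-+ n f g))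
  (interchange (sumTo n f) (sumTo n g) (f (suc n)) (g (suc n)))
  where open CommSemigroupProperties ℤP.+-commutativeSemigroup using (interchange)

sumTo-*ˡ : ∀ n c (f : ℕ → ℤ) → sumTo n (λ i → c *ℤ f i) ≡ c *ℤ sumTo n f
sumTo-*ˡ zero    c f = refl
sumTo-*ˡ (suc n) c f = trans (cong (_+ℤ c *ℤ f (suc n)) (sumTo-*ˡ n c f))
  (sym (ℤP.*-distribˡ-+ c (sumTo n f) (f (suc n))))

sumTo-*ʳ : ∀ n c (f : ℕ → ℤ) → sumTo n (λ i → f i *ℤ c) ≡ sumTo n f *ℤ c
sumTo-*ʳ zero    c f = refl
sumTo-*ʳ (suc n) c f = trans (cong (_+ℤ f (suc n) *ℤ c) (sumTo-*ʳ n c f))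
  (sym (ℤP.*-distribʳ-+ c (sumTo n f) (f (suc n))))

sumTo-sucˡ : ∀ n (f : ℕ → ℤ) → sumTo (suc n) f ≡ f 0 +ℤ sumTo n (f ∘ suc)
sumTo-sucˡ zero    f = refl
sumTo-sucˡ (suc n) f = trans (cong (_+ℤ f (suc (suc n))) (sumTo-sucˡ n f))
  (ℤP.+-assoc (f 0) (sumTo n (f ∘ suc)) (f (suc (suc n))))

sumTo-reverse : ∀ n (f : ℕ → ℤ) → sumTo n (λ i → f (n ∸ i)) ≡ sumTo n f
sumTo-reverse zero    f = refl
sumTo-reverse (suc n) f = trans (sumTo-sucˡ n (λ i → f (suc n ∸ i)))
  (trans (cong (f (suc n) +ℤ_) (sumTo-reverse n f)) (ℤP.+-comm (f (suc n)) (sumTo n f)))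

sumTo-δ-beyond : ∀ n a (g : ℕ → ℤ) → n < a → sumTo n (λ i → [ i ℕ.≟ a ] *ℤ g i) ≡ + 0
sumTo-δ-beyond n a g n<a = sumTo-zero n λ i i≤n →
  cong (_*ℤ g i) ([no] (i ℕ.≟ a) (λ i≡a → ℕP.<-irrefl i≡a (ℕP.≤-<-trans i≤n n<a)))

sumTo-δ : ∀ n a (g : ℕ → ℤ) → a ≤ n → sumTo n (λ i → [ i ℕ.≟ a ] *ℤ g i) ≡ g a
sumTo-δ zero    .zero g z≤n = ℤP.*-identityˡ (g 0)
sumTo-δ (suc n) a     g a≤1+n with a ℕ.≟ suc n
... | yes refl = begin
    sumTo n (λ i → [ i ℕ.≟ suc n ] *ℤ g i) +ℤ [ suc n ℕ.≟ suc n ] *ℤ g (suc n)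
  ≡⟨ cong₂ _+ℤ_ (sumTo-δ-beyond n (suc n) g ℕP.≤-refl) (cong (_*ℤ g (suc n)) ([yes] (suc n ℕ.≟ suc n) refl)) ⟩
    + 0 +ℤ + 1 *ℤ g (suc n)
  ≡⟨ trans (ℤP.+-identityˡ _) (ℤP.*-identityˡ (g (suc n))) ⟩
    g (suc n)
  ∎
  where open ≡-Reasoning
... | no a≢1+n = begin
    sumTo n (λ i → [ i ℕ.≟ a ] *ℤ g i) +ℤ [ suc n ℕ.≟ a ] *ℤ g (suc n)
  ≡⟨ cong₂ _+ℤ_ (sumTo-δ n a g (ℕP.≤-pred (ℕP.≤∧≢⇒< a≤1+n a≢1+n)))
                (cong (_*ℤ g (suc n)) ([no] (suc n ℕ.≟ a) (a≢1+n ∘ sym))) ⟩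
    g a +ℤ + 0
  ≡⟨ ℤP.+-identityʳ (g a) ⟩
    g a
  ∎
  where open ≡-Reasoning

sumTo-exchange : ∀ n (h : ℕ → ℕ → ℤ) →
  sumTo n (λ i → sumTo i (λ j → h j (i ∸ j))) ≡ sumTo n (λ j → sumTo (n ∸ j) (h j))
sumTo-exchange zero    h = refl
sumTo-exchange (suc n) h = begin
    sumTo n (λ i → sumTo i (λ j → h j (i ∸ j))) +ℤ sumTo (suc n) (λ j → h j (suc n ∸ j))
  ≡⟨ cong (_+ℤ sumTo (suc n) (λ j → h j (suc n ∸ j))) (sumTo-exchange n h) ⟩
    sumTo n (λ j → sumTo (n ∸ j) (h j)) +ℤ (sumTo n (λ j → h j (suc n ∸ j)) +ℤ h (suc n) (n ∸ n))
  ≡⟨ sym (ℤP.+-assoc (sumTo n (λ j → sumTo (n ∸ j) (h j))) _ _) ⟩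
    (sumTo n (λ j → sumTo (n ∸ j) (h j)) +ℤ sumTo n (λ j → h j (suc n ∸ j))) +ℤ h (suc n) (n ∸ n)
  ≡⟨ cong (_+ℤ h (suc n) (n ∸ n)) (sym (sumTo-+ n _ _)) ⟩
    sumTo n (λ j → sumTo (n ∸ j) (h j) +ℤ h j (suc n ∸ j)) +ℤ h (suc n) (n ∸ n)
  ≡⟨ cong₂ _+ℤ_ (sumTo-cong n extend) last ⟩
    sumTo (suc n) (λ j → sumTo (suc n ∸ j) (h j))
  ∎
  where
  open ≡-Reasoning
  extend : ∀ j → j ≤ n → sumTo (n ∸ j) (h j) +ℤ h j (suc n ∸ j) ≡ sumTo (suc n ∸ j) (h j)
  extend j j≤n rewrite ℕP.+-∸-assoc 1 j≤n = refl
  last : h (suc n) (n ∸ n) ≡ sumTo (n ∸ n) (h (suc n))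
  last rewrite ℕP.n∸n≡0 n = refl

-- The ring ℤ[[q]]

infix  4 _≈_
infixl 6 _⊕_ _⊖_
infixl 7 _⊗_
infix  8 ⊖_

record _≈_ (a b : Series) : Set where
  constructor mk≈
  field at : ∀ n → a n ≡ b n
open _≈_ public

-- Opaque, so that unification meets a ⊗ b rather than an η-expanded convolution sum.
opaque
  _⊕_ : Series → Series → Series
  (a ⊕ b) n = a n +ℤ b n

  ⊖_ : Series → Series
  (⊖ a) n = - a n

  _⊗_ : Series → Series → Series
  _⊗_ = mul

_⊖_ : Series → Series → Series
a ⊖ b = a ⊕ ⊖ b

𝟘 : Series
𝟘 _ = + 0

≈-refl : ∀ {a} → a ≈ a
≈-refl = mk≈ λ _ → refl

≈-sym : ∀ {a b} → a ≈ b → b ≈ a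
≈-sym a≈b = mk≈ λ n → sym (at a≈b n)

≈-trans : ∀ {a b c} → a ≈ b → b ≈ c → a ≈ c
≈-trans a≈b b≈c = mk≈ λ n → trans (at a≈b n) (at b≈c n)

≡⇒≈ : ∀ {a b} → a ≡ b → a ≈ b
≡⇒≈ refl = ≈-refl

opaque
  unfolding _⊕_ ⊖_ _⊗_

  ⊕-at : ∀ a b n → (a ⊕ b) n ≡ a n +ℤ b n
  ⊕-at a b n = refl

  ⊖-at : ∀ a n → (⊖ a) n ≡ - a n
  ⊖-at a n = refl

  ⊗-at : ∀ a b n → (a ⊗ b) n ≡ mul a b n
  ⊗-at a b n = refl

  ⊕-cong : ∀ {a a′ b b′} → a ≈ a′ → b ≈ b′ → a ⊕ b ≈ a′ ⊕ b′
  ⊕-cong a≈a′ b≈b′ = mk≈ λ n → cong₂ _+ℤ_ (at a≈a′ n) (at b≈b′ n)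

  ⊖-cong : ∀ {a a′} → a ≈ a′ → ⊖ a ≈ ⊖ a′
  ⊖-cong a≈a′ = mk≈ λ n → cong -_ (at a≈a′ n)

  ⊗-cong : ∀ {a a′ b b′} → a ≈ a′ → b ≈ b′ → a ⊗ b ≈ a′ ⊗ b′
  ⊗-cong a≈a′ b≈b′ = mk≈ λ n → sumTo-cong n λ i _ → cong₂ _*ℤ_ (at a≈a′ i) (at b≈b′ (n ∸ i))

  ⊕-assoc : ∀ a b c → (a ⊕ b) ⊕ c ≈ a ⊕ (b ⊕ c)
  ⊕-assoc a b c = mk≈ λ n → ℤP.+-assoc (a n) (b n) (c n)

  ⊕-comm : ∀ a b → a ⊕ b ≈ b ⊕ a
  ⊕-comm a b = mk≈ λ n → ℤP.+-comm (a n) (b n)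

  ⊕-identityˡ : ∀ a → 𝟘 ⊕ a ≈ a
  ⊕-identityˡ a = mk≈ λ n → ℤP.+-identityˡ (a n)

  ⊕-identityʳ : ∀ a → a ⊕ 𝟘 ≈ a
  ⊕-identityʳ a = mk≈ λ n → ℤP.+-identityʳ (a n)

  ⊕-inverseˡ : ∀ a → ⊖ a ⊕ a ≈ 𝟘
  ⊕-inverseˡ a = mk≈ λ n → ℤP.+-inverseˡ (a n)

  ⊕-inverseʳ : ∀ a → a ⊕ ⊖ a ≈ 𝟘
  ⊕-inverseʳ a = mk≈ λ n → ℤP.+-inverseʳ (a n)

  ⊗-comm : ∀ a b → a ⊗ b ≈ b ⊗ a
  ⊗-comm a b = mk≈ λ n → trans (sym (sumTo-reverse n (λ i → a i *ℤ b (n ∸ i))))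
    (sumTo-cong n λ i i≤n → trans (cong (λ k → a (n ∸ i) *ℤ b k) (ℕP.m∸[m∸n]≡n i≤n))
                                   (ℤP.*-comm (a (n ∸ i)) (b i)))

  ⊗-identityˡ : ∀ a → one ⊗ a ≈ a
  ⊗-identityˡ a = mk≈ λ n → sumTo-δ n 0 (λ i → a (n ∸ i)) z≤n

  ⊗-distribˡ-⊕ : ∀ a b c → a ⊗ (b ⊕ c) ≈ a ⊗ b ⊕ a ⊗ c
  ⊗-distribˡ-⊕ a b c = mk≈ λ n →
    trans (sumTo-cong n (λ i _ → ℤP.*-distribˡ-+ (a i) (b (n ∸ i)) (c (n ∸ i)))) (sumTo-+ n _ _)

  ⊗-assoc : ∀ a b c → (a ⊗ b) ⊗ c ≈ a ⊗ (b ⊗ c)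
  ⊗-assoc a b c = mk≈ λ n → begin
      sumTo n (λ i → sumTo i (λ j → a j *ℤ b (i ∸ j)) *ℤ c (n ∸ i))
    ≡⟨ sumTo-cong n (λ i i≤n → trans (sym (sumTo-*ʳ i (c (n ∸ i)) _))
                                      (sumTo-cong i λ j j≤i → reassociate n i j i≤n j≤i)) ⟩
      sumTo n (λ i → sumTo i (λ j → h n j (i ∸ j)))
    ≡⟨ sumTo-exchange n (h n) ⟩
      sumTo n (λ j → sumTo (n ∸ j) (h n j))
    ≡⟨ sumTo-cong n (λ j _ → sumTo-*ˡ (n ∸ j) (a j) _) ⟩
      sumTo n (λ j → a j *ℤ sumTo (n ∸ j) (λ k → b k *ℤ c (n ∸ j ∸ k)))
    ∎
    where
    open ≡-Reasoning
    h : ℕ → ℕ → ℕ → ℤ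
    h n j k = a j *ℤ (b k *ℤ c (n ∸ j ∸ k))
    reassociate : ∀ n i j → i ≤ n → j ≤ i → a j *ℤ b (i ∸ j) *ℤ c (n ∸ i) ≡ h n j (i ∸ j)
    reassociate n i j i≤n j≤i = trans (ℤP.*-assoc (a j) _ _) (cong (λ m → a j *ℤ (b (i ∸ j) *ℤ c m))
      (sym (trans (ℕP.∸-+-assoc n j (i ∸ j)) (cong (n ∸_) (ℕP.m+[n∸m]≡n j≤i)))))

series-commutativeRing : CommutativeRing _ _
series-commutativeRing = record
  { Carrier = Series ; _≈_ = _≈_ ; _+_ = _⊕_ ; _*_ = _⊗_ ; -_ = ⊖_ ; 0# = 𝟘 ; 1# = one
  ; isCommutativeRing = record
    { isRing = record
      { +-isAbelianGroup = record
        { isGroup = record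
          { isMonoid = record
            { isSemigroup = record
              { isMagma = record
                { isEquivalence = record { refl = ≈-refl ; sym = ≈-sym ; trans = ≈-trans }
                ; ∙-cong = ⊕-cong }
              ; assoc = ⊕-assoc }
            ; identity = ⊕-identityˡ , ⊕-identityʳ }
          ; inverse = ⊕-inverseˡ , ⊕-inverseʳ
          ; ⁻¹-cong = ⊖-cong }
        ; comm = ⊕-comm }
      ; *-cong = ⊗-cong
      ; *-assoc = ⊗-assoc
      ; *-identity = ⊗-identityˡ , λ a → ≈-trans (⊗-comm a one) (⊗-identityˡ a)
      ; distrib = ⊗-distribˡ-⊕ , λ a b c → ≈-trans (⊗-comm (b ⊕ c) a)
          (≈-trans (⊗-distribˡ-⊕ a b c) (⊕-cong (⊗-comm a b) (⊗-comm a c))) }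
    ; *-comm = ⊗-comm } }

open CommutativeRing series-commutativeRing public
  using () renaming (zeroˡ to ⊗-zeroˡ; zeroʳ to ⊗-zeroʳ; *-identityʳ to ⊗-identityʳ)

module ≈-Reasoning = Relation.Binary.Reasoning.Setoid (CommutativeRing.setoid series-commutativeRing)

-- Defined by the same test as one, so that the solver's constant ι (+ 1) is definitionally one.
ι : ℤ → Series
ι c n = if does (n ℕ.≟ 0) then c else + 0

ι-⊗ : ∀ c a n → (ι c ⊗ a) n ≡ c *ℤ a n
ι-⊗ c a zero    = ⊗-at (ι c) a 0
ι-⊗ c a (suc n) = begin
    (ι c ⊗ a) (suc n)
  ≡⟨ ⊗-at (ι c) a (suc n) ⟩
    sumTo (suc n) (λ i → ι c i *ℤ a (suc n ∸ i))
  ≡⟨ sumTo-sucˡ n _ ⟩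
    c *ℤ a (suc n) +ℤ sumTo n (λ i → + 0 *ℤ a (n ∸ i))
  ≡⟨ cong (c *ℤ a (suc n) +ℤ_) (sumTo-zero n (λ _ _ → refl)) ⟩
    c *ℤ a (suc n) +ℤ + 0
  ≡⟨ ℤP.+-identityʳ _ ⟩
    c *ℤ a (suc n)
  ∎
  where open ≡-Reasoning

ι-+ : ∀ c d n → ι c n +ℤ ι d n ≡ ι (c +ℤ d) n
ι-+ c d zero    = refl
ι-+ c d (suc n) = refl

ι-morphism : CommutativeRing.rawRing ℤP.+-*-commutativeRing
               ACR.-Raw-AlmostCommutative⟶ ACR.fromCommutativeRing series-commutativeRing
ι-morphism = record
  { ⟦_⟧    = ι
  ; +-homo = λ c d → mk≈ λ n → sym (trans (⊕-at (ι c) (ι d) n) (ι-+ c d n))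
  ; *-homo = λ c d → mk≈ λ { zero → sym (ι-⊗ c (ι d) 0) ; (suc n) → sym (trans (ι-⊗ c (ι d) (suc n)) (ℤP.*-zeroʳ c)) }
  ; -‿homo = λ c → mk≈ λ { zero → sym (⊖-at (ι c) 0) ; (suc n) → sym (⊖-at (ι c) (suc n)) }
  ; 0-homo = mk≈ λ { zero → refl ; (suc n) → refl }
  ; 1-homo = ≈-refl
  }

ι-equal? : ∀ c d → Maybe (ι c ≈ ι d)
ι-equal? c d with c ℤ.≟ d
... | yes refl = just ≈-refl
... | no _     = nothing

open Algebra.Solver.Ring _ (ACR.fromCommutativeRing series-commutativeRing) ι-morphism ι-equal?
  using (_:=_; _:+_; _:*_; _:-_; :-_; _:^_; con) renaming (solve to solveˢ)

q^_ : ℕ → Series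
(q^ d) n = [ n ℕ.≟ d ]

shift : ℕ → Series → Series
shift zero    a         = a
shift (suc d) a zero    = + 0
shift (suc d) a (suc n) = shift d a n

shift-≥ : ∀ d a n → d ≤ n → shift d a n ≡ a (n ∸ d)
shift-≥ zero    a n       _         = refl
shift-≥ (suc d) a (suc n) (s≤s d≤n) = shift-≥ d a n d≤n

shift-< : ∀ d a n → n < d → shift d a n ≡ + 0
shift-< (suc d) a zero    _         = refl
shift-< (suc d) a (suc n) (s≤s n<d) = shift-< d a n n<d

q^-⊗ : ∀ d a → q^ d ⊗ a ≈ shift d a
q^-⊗ d a = mk≈ λ n → case n (d ℕ.≤? n)
  where
  case : ∀ n → Dec (d ≤ n) → (q^ d ⊗ a) n ≡ shift d a n
  case n (yes d≤n) = trans (⊗-at (q^ d) a n) $ trans (sumTo-δ n d (λ i → a (n ∸ i)) d≤n) (sym (shift-≥ d a n d≤n))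
  case n (no d≰n)  = trans (⊗-at (q^ d) a n) $ trans (sumTo-δ-beyond n d (λ i → a (n ∸ i)) (ℕP.≰⇒> d≰n))
                           (sym (shift-< d a n (ℕP.≰⇒> d≰n)))

shift-q^ : ∀ d e → shift d (q^ e) ≈ q^ (d + e)
shift-q^ zero    e = ≈-refl
shift-q^ (suc d) e = mk≈ λ { zero → refl ; (suc n) → at (shift-q^ d e) n }

q^-+ : ∀ d e → q^ (d + e) ≈ q^ d ⊗ q^ e
q^-+ d e = ≈-sym (≈-trans (q^-⊗ d (q^ e)) (shift-q^ d e))

oneMinus≈ : ∀ d → oneMinus d ≈ one ⊖ q^ d
oneMinus≈ d = mk≈ λ n → sym (trans (⊕-at one (⊖ q^ d) n) (cong ([ n ℕ.≟ 0 ] +ℤ_) (⊖-at (q^ d) n)))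

q^-≡ : ∀ {d e} → d ≡ e → q^ d ≈ q^ e
q^-≡ refl = ≈-refl

q^≈₂ : ∀ {d} e₁ e₂ → d ≡ e₁ + e₂ → q^ d ≈ q^ e₁ ⊗ q^ e₂
q^≈₂ e₁ e₂ d≡ = ≈-trans (q^-≡ d≡) (q^-+ e₁ e₂)

q^≈₃ : ∀ {d} e₁ e₂ e₃ → d ≡ e₁ + e₂ + e₃ → q^ d ≈ q^ e₁ ⊗ q^ e₂ ⊗ q^ e₃
q^≈₃ e₁ e₂ e₃ d≡ = ≈-trans (q^≈₂ (e₁ + e₂) e₃ d≡) (⊗-cong (q^-+ e₁ e₂) ≈-refl)

q^≈₄ : ∀ {d} e₁ e₂ e₃ e₄ → d ≡ e₁ + e₂ + e₃ + e₄ → q^ d ≈ q^ e₁ ⊗ q^ e₂ ⊗ q^ e₃ ⊗ q^ e₄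
q^≈₄ e₁ e₂ e₃ e₄ d≡ = ≈-trans (q^≈₂ (e₁ + e₂ + e₃) e₄ d≡) (⊗-cong (q^≈₃ e₁ e₂ e₃ refl) ≈-refl)

q^-⊗-q^ : ∀ {d₁ d₂ m} → q^ (d₁ + d₂) ≈ m → q^ d₁ ⊗ q^ d₂ ≈ m
q^-⊗-q^ {d₁} {d₂} h = ≈-trans (≈-sym (q^-+ d₁ d₂)) h

oneMinus-≈ : ∀ {d m} → q^ d ≈ m → oneMinus d ≈ one ⊖ m
oneMinus-≈ {d} q^d≈m = ≈-trans (oneMinus≈ d) (⊕-cong ≈-refl (⊖-cong q^d≈m))

oneMinus-0 : oneMinus 0 ≈ 𝟘
oneMinus-0 = mk≈ λ n → ℤP.+-inverseʳ [ n ℕ.≟ 0 ]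

infix 4 _≈_[q^_]

record _≈_[q^_] (a b : Series) (D : ℕ) : Set where
  constructor mk≈[q^]
  field below : ∀ n → n < D → a n ≡ b n
open _≈_[q^_] public

≈⇒≈[q^] : ∀ {a b} D → a ≈ b → a ≈ b [q^ D ]
≈⇒≈[q^] D a≈b = mk≈[q^] λ n _ → at a≈b n

≈[q^]-refl : ∀ {a D} → a ≈ a [q^ D ]
≈[q^]-refl = mk≈[q^] λ _ _ → refl

≈[q^]-sym : ∀ {a b D} → a ≈ b [q^ D ] → b ≈ a [q^ D ]
≈[q^]-sym a≈b = mk≈[q^] λ n n<D → sym (below a≈b n n<D)

≈[q^]-trans : ∀ {a b c D} → a ≈ b [q^ D ] → b ≈ c [q^ D ] → a ≈ c [q^ D ]
≈[q^]-trans a≈b b≈c = mk≈[q^] λ n n<D → trans (below a≈b n n<D) (below b≈c n n<D)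

≈[q^]-≈ : ∀ {a b c D} → a ≈ b [q^ D ] → b ≈ c → a ≈ c [q^ D ]
≈[q^]-≈ {D = D} a≈b b≈c = ≈[q^]-trans a≈b (≈⇒≈[q^] D b≈c)

≈-≈[q^] : ∀ {a b c D} → a ≈ b → b ≈ c [q^ D ] → a ≈ c [q^ D ]
≈-≈[q^] {D = D} a≈b b≈c = ≈[q^]-trans (≈⇒≈[q^] D a≈b) b≈c

≈[q^]-weaken : ∀ {a b D E} → E ≤ D → a ≈ b [q^ D ] → a ≈ b [q^ E ]
≈[q^]-weaken E≤D a≈b = mk≈[q^] λ n n<E → below a≈b n (ℕP.<-≤-trans n<E E≤D)

⊕-cong[q^] : ∀ {a a′ b b′ D} → a ≈ a′ [q^ D ] → b ≈ b′ [q^ D ] → a ⊕ b ≈ a′ ⊕ b′ [q^ D ]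
⊕-cong[q^] {a} {a′} {b} {b′} a≈a′ b≈b′ = mk≈[q^] λ n n<D →
  trans (⊕-at a b n) $ flip trans (sym (⊕-at a′ b′ n)) $ cong₂ _+ℤ_ (below a≈a′ n n<D) (below b≈b′ n n<D)

⊗-cong[q^] : ∀ {a a′ b b′ D} → a ≈ a′ [q^ D ] → b ≈ b′ [q^ D ] → a ⊗ b ≈ a′ ⊗ b′ [q^ D ]
⊗-cong[q^] {a} {a′} {b} {b′} a≈a′ b≈b′ = mk≈[q^] λ n n<D →
  trans (⊗-at a b n) $ flip trans (sym (⊗-at a′ b′ n)) $ sumTo-cong n λ i i≤n →
    cong₂ _*ℤ_ (below a≈a′ i (ℕP.≤-<-trans i≤n n<D))
               (below b≈b′ (n ∸ i) (ℕP.≤-<-trans (ℕP.m∸n≤m n i) n<D))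

shift-cong[q^] : ∀ d {a b D} → a ≈ b [q^ D ] → shift d a ≈ shift d b [q^ d + D ]
shift-cong[q^] zero    a≈b = a≈b
shift-cong[q^] (suc d) a≈b = mk≈[q^] λ
  { zero    _           → refl
  ; (suc n) (s≤s n<d+D) → below (shift-cong[q^] d a≈b) n n<d+D }

q^-≈𝟘 : ∀ d → q^ d ≈ 𝟘 [q^ d ]
q^-≈𝟘 d = mk≈[q^] λ n n<d → [no] (n ℕ.≟ d) (λ n≡d → ℕP.<-irrefl n≡d n<d)

diagonal : (ℕ → Series) → Series
diagonal s N = s N N

diagonal-≈ : ∀ (s : ℕ → Series) (B : ℕ → ℕ) → (∀ N → N < B N) → (∀ m d → s (d + m) ≈ s m [q^ B m ]) →
  ∀ n → diagonal s ≈ s n [q^ B n ]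
diagonal-≈ s B N<BN stable n = mk≈[q^] λ N N<Bn → case N N<Bn (ℕP.≤-total N n)
  where
  case : ∀ N → N < B n → N ≤ n ⊎ n ≤ N → s N N ≡ s n N
  case N _    (inj₁ N≤n) = sym (subst (λ m → s m N ≡ s N N) (ℕP.m∸n+n≡m N≤n)
                                      (below (stable N (n ∸ N)) N (N<BN N)))
  case N N<Bn (inj₂ n≤N) = subst (λ m → s m N ≡ s n N) (ℕP.m∸n+n≡m n≤N)
                                 (below (stable n (N ∸ n)) N N<Bn)

q^-⊗-≈[q^] : ∀ e {Y D} → Y ≈ one [q^ D ] → q^ e ⊗ Y ≈ q^ e [q^ e + D ]
q^-⊗-≈[q^] e Y≈1 = ≈-≈[q^] (q^-⊗ e _)
  (≈[q^]-≈ (shift-cong[q^] e Y≈1) (≈-trans (shift-q^ e 0) (q^-≡ (ℕP.+-identityʳ e))))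

⊗-interchange : ∀ a b c d → (a ⊗ b) ⊗ (c ⊗ d) ≈ (a ⊗ c) ⊗ (b ⊗ d)
⊗-interchange = solveˢ 4 (λ a b c d → (a :* b) :* (c :* d) := (a :* c) :* (b :* d)) ≈-refl

∏ : ℕ → (ℕ → Series) → Series
∏ zero    F = one
∏ (suc K) F = F (suc K) ⊗ ∏ K F

prodTo≈∏ : ∀ K F → prodTo K F ≈ ∏ K F
prodTo≈∏ zero    F = ≈-refl
prodTo≈∏ (suc K) F = mk≈ λ n → trans
  (sumTo-cong n λ i _ → cong (F (suc K) i *ℤ_) (at (prodTo≈∏ K F) (n ∸ i)))
  (sym (⊗-at (F (suc K)) (∏ K F) n))

∏-cong : ∀ K {F G : ℕ → Series} → (∀ k → F (suc k) ≈ G (suc k)) → ∏ K F ≈ ∏ K G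
∏-cong zero    F≈G = ≈-refl
∏-cong (suc K) F≈G = ⊗-cong (F≈G K) (∏-cong K F≈G)

∏-⊗ : ∀ K (F G : ℕ → Series) → ∏ K F ⊗ ∏ K G ≈ ∏ K (λ k → F k ⊗ G k)
∏-⊗ zero    F G = ⊗-identityˡ one
∏-⊗ (suc K) F G = ≈-trans (⊗-interchange (F (suc K)) (∏ K F) (G (suc K)) (∏ K G))
                          (⊗-cong ≈-refl (∏-⊗ K F G))

∏-≈one : ∀ K {F : ℕ → Series} → (∀ k → F (suc k) ≈ one) → ∏ K F ≈ one
∏-≈one zero    F≈1 = ≈-refl
∏-≈one (suc K) F≈1 = ≈-trans (⊗-cong (F≈1 K) (∏-≈one K F≈1)) (⊗-identityˡ one)

∏-+ : ∀ d a F → ∏ (d + a) F ≈ ∏ d (λ i → F (i + a)) ⊗ ∏ a F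
∏-+ zero    a F = ≈-sym (⊗-identityˡ _)
∏-+ (suc d) a F = ≈-trans (⊗-cong ≈-refl (∏-+ d a F)) (≈-sym (⊗-assoc _ _ _))

∏-≈one[q^] : ∀ K {F D} → (∀ k → F (suc k) ≈ one [q^ D ]) → ∏ K F ≈ one [q^ D ]
∏-≈one[q^] zero    F≈1 = ≈[q^]-refl
∏-≈one[q^] (suc K) F≈1 = ≈[q^]-≈ (⊗-cong[q^] (F≈1 K) (∏-≈one[q^] K F≈1)) (⊗-identityˡ one)

∏-pairs : ∀ K (F : ℕ → Series) → ∏ (K + K) F ≈ ∏ K (λ k → F (k + k ∸ 1) ⊗ F (k + k))
∏-pairs zero    F = ≈-refl
∏-pairs (suc K) F rewrite ℕP.+-suc K K =
  ≈-trans (≈-sym (⊗-assoc (F (suc (suc (K + K)))) (F (suc (K + K))) (∏ (K + K) F)))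
          (⊗-cong (⊗-comm _ _) (∏-pairs K F))

n<h*[1+n] : ∀ h .{{_ : ℕ.NonZero h}} n → n < h * suc n
n<h*[1+n] h n = ℕP.m≤n*m (suc n) h

-- f h and fInv h are prod∞ of their factors: the coefficient of q^n only involves the first n.
prod∞ : (ℕ → Series) → Series
prod∞ F = diagonal (λ K → prodTo K F)

module _ (h : ℕ) {F : ℕ → Series} (F≈1 : ∀ k → F (suc k) ≈ one [q^ h * suc k ]) where

  ∏-stable : ∀ K d → ∏ (d + K) F ≈ ∏ K F [q^ h * suc K ]
  ∏-stable K zero    = ≈[q^]-refl
  ∏-stable K (suc d) = ≈[q^]-trans
    (⊗-cong[q^] (≈[q^]-weaken (ℕP.*-monoʳ-≤ h (s≤s (ℕP.m≤n+m K d))) (F≈1 (d + K))) ≈[q^]-refl)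
    (≈-≈[q^] (⊗-identityˡ _) (∏-stable K d))

  prod∞-≈-∏ : .{{_ : ℕ.NonZero h}} → ∀ K → prod∞ F ≈ ∏ K F [q^ h * suc K ]
  prod∞-≈-∏ K = ≈-≈[q^] (mk≈ λ N → at (prodTo≈∏ N F) N)
    (diagonal-≈ (λ K → ∏ K F) (λ K → h * suc K) (n<h*[1+n] h) ∏-stable K)

oneMinus-≈[q^] : ∀ d → oneMinus d ≈ one [q^ d ]
oneMinus-≈[q^] d = mk≈[q^] λ n n<d →
  trans (cong (λ x → [ n ℕ.≟ 0 ] +ℤ - x) ([no] (n ℕ.≟ d) (λ n≡d → ℕP.<-irrefl n≡d n<d)))
        (ℤP.+-identityʳ _)

geom-≈[q^] : ∀ d → geom d ≈ one [q^ d ]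
geom-≈[q^] d = mk≈[q^] λ
  { zero    _     → [yes] (d ∣? 0) (d ℕ∣.∣0)
  ; (suc n) 1+n<d → [no] (d ∣? suc n) (λ d∣1+n → ℕP.<⇒≱ 1+n<d (ℕ∣.∣⇒≤ d∣1+n)) }

oneMinus-⊗-geom : ∀ d → 1 ≤ d → oneMinus d ⊗ geom d ≈ one
oneMinus-⊗-geom d 1≤d = ≈-trans (⊗-cong (oneMinus≈ d) ≈-refl) $ ≈-trans (expand (geom d) (q^ d)) $
  ≈-trans (⊕-cong ≈-refl (⊖-cong (q^-⊗ d (geom d)))) $ mk≈ λ n →
    trans (⊕-at _ _ n) (trans (cong (geom d n +ℤ_) (⊖-at _ n)) (telescope n (d ℕ.≤? n)))
  where
  expand : ∀ g x → (one ⊖ x) ⊗ g ≈ g ⊖ x ⊗ g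
  expand = solveˢ 2 (λ g x → (con (+ 1) :- x) :* g := g :- x :* g) ≈-refl
  telescope : ∀ n → Dec (d ≤ n) → geom d n +ℤ - shift d (geom d) n ≡ one n
  telescope n (yes d≤n) rewrite shift-≥ d (geom d) n d≤n =
    trans (cong (_+ℤ - geom d (n ∸ d)) ([]-cong (d ∣? n) (d ∣? (n ∸ d)) d∣n⇒ d∣n∸d⇒))
    (trans (ℤP.+-inverseʳ (geom d (n ∸ d))) (sym ([no] (n ℕ.≟ 0) (λ n≡0 → ℕP.<⇒≱ 1≤d (subst (d ≤_) n≡0 d≤n)))))
    where
    d+[n∸d]≡n : d + (n ∸ d) ≡ n
    d+[n∸d]≡n = ℕP.m+[n∸m]≡n d≤n
    d∣n⇒ : d ∣ n → d ∣ n ∸ d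
    d∣n⇒ d∣n = ℕ∣.∣m+n∣m⇒∣n (subst (d ∣_) (sym d+[n∸d]≡n) d∣n) ℕ∣.∣-refl
    d∣n∸d⇒ : d ∣ n ∸ d → d ∣ n
    d∣n∸d⇒ d∣n∸d = subst (d ∣_) d+[n∸d]≡n (ℕ∣.∣m∣n⇒∣m+n ℕ∣.∣-refl d∣n∸d)
  telescope n (no d≰n) rewrite shift-< d (geom d) n (ℕP.≰⇒> d≰n) =
    trans (ℤP.+-identityʳ _) (below (geom-≈[q^] d) n (ℕP.≰⇒> d≰n))

fTo : ℕ → ℕ → Series
fTo h K = ∏ K (λ k → oneMinus (h * k))

fInvTo : ℕ → ℕ → Series
fInvTo h K = ∏ K (λ k → geom (h * k))

f-≈-fTo : ∀ h .{{_ : ℕ.NonZero h}} K → f h ≈ fTo h K [q^ h * suc K ]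
f-≈-fTo h = prod∞-≈-∏ h (λ k → oneMinus-≈[q^] (h * suc k))

fInv-≈-fInvTo : ∀ h .{{_ : ℕ.NonZero h}} K → fInv h ≈ fInvTo h K [q^ h * suc K ]
fInv-≈-fInvTo h = prod∞-≈-∏ h (λ k → geom-≈[q^] (h * suc k))

fTo-⊗-fInvTo : ∀ h .{{_ : ℕ.NonZero h}} K → fTo h K ⊗ fInvTo h K ≈ one
fTo-⊗-fInvTo h K = ≈-trans (∏-⊗ K _ _)
  (∏-≈one K λ k → oneMinus-⊗-geom (h * suc k) (ℕP.≤-trans (s≤s z≤n) (ℕP.m≤n*m (suc k) h)))

f-⊗-fInv : ∀ h .{{_ : ℕ.NonZero h}} → f h ⊗ fInv h ≈ one
f-⊗-fInv h = mk≈ λ n → below (≈[q^]-≈ (⊗-cong[q^] (f-≈-fTo h n) (fInv-≈-fInvTo h n)) (fTo-⊗-fInvTo h n))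
  n (n<h*[1+n] h n)

∑ : ℕ → (ℕ → Series) → Series
∑ zero    F = 𝟘
∑ (suc M) F = ∑ M F ⊕ F (suc M)

∑-cong : ∀ M {F G : ℕ → Series} → (∀ j → F (suc j) ≈ G (suc j)) → ∑ M F ≈ ∑ M G
∑-cong zero    F≈G = ≈-refl
∑-cong (suc M) F≈G = ⊕-cong (∑-cong M F≈G) (F≈G M)

∑-cong[q^] : ∀ M {F G : ℕ → Series} {D} → (∀ j → suc j ≤ M → F (suc j) ≈ G (suc j) [q^ D ]) →
  ∑ M F ≈ ∑ M G [q^ D ]
∑-cong[q^] zero    F≈G = ≈[q^]-refl
∑-cong[q^] (suc M) F≈G = ⊕-cong[q^] (∑-cong[q^] M λ j j<M → F≈G j (ℕP.m≤n⇒m≤1+n j<M)) (F≈G M ℕP.≤-refl)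

∑-⊕ : ∀ M F G → ∑ M (λ j → F j ⊕ G j) ≈ ∑ M F ⊕ ∑ M G
∑-⊕ zero    F G = ≈-sym (⊕-identityˡ 𝟘)
∑-⊕ (suc M) F G = ≈-trans (⊕-cong (∑-⊕ M F G) ≈-refl) (interchange _ _ _ _)
  where
  interchange : ∀ a b c d → (a ⊕ b) ⊕ (c ⊕ d) ≈ (a ⊕ c) ⊕ (b ⊕ d)
  interchange = solveˢ 4 (λ a b c d → (a :+ b) :+ (c :+ d) := (a :+ c) :+ (b :+ d)) ≈-refl

∑-⊗ˡ : ∀ M a F → ∑ M (λ j → a ⊗ F j) ≈ a ⊗ ∑ M F
∑-⊗ˡ zero    a F = ≈-sym (⊗-zeroʳ a)
∑-⊗ˡ (suc M) a F = ≈-trans (⊕-cong (∑-⊗ˡ M a F) ≈-refl) (≈-sym (⊗-distribˡ-⊕ a _ _))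

∑-⊗ʳ : ∀ M a F → ∑ M (λ j → F j ⊗ a) ≈ ∑ M F ⊗ a
∑-⊗ʳ M a F = ≈-trans (∑-cong M (λ j → ⊗-comm (F (suc j)) a)) (≈-trans (∑-⊗ˡ M a F) (⊗-comm a _))

∑-pred : ∀ M F → ∑ (suc M) (λ j → F (j ∸ 1)) ≈ F 0 ⊕ ∑ M F
∑-pred zero    F = ≈-trans (⊕-identityˡ (F 0)) (≈-sym (⊕-identityʳ (F 0)))
∑-pred (suc M) F = ≈-trans (⊕-cong (∑-pred M F) ≈-refl) (⊕-assoc _ _ _)

∑-suc : ∀ M F → ∑ M (F ∘ suc) ⊕ F 1 ≈ ∑ (suc M) F
∑-suc zero    F = ≈-refl
∑-suc (suc M) F = ≈-trans (swap _ _ _) (⊕-cong (∑-suc M F) ≈-refl)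
  where
  swap : ∀ a b c → (a ⊕ b) ⊕ c ≈ (a ⊕ c) ⊕ b
  swap = solveˢ 3 (λ a b c → (a :+ b) :+ c := (a :+ c) :+ b) ≈-refl

∑-last-𝟘 : ∀ M F → F (suc M) ≈ 𝟘 → ∑ (suc M) F ≈ ∑ M F
∑-last-𝟘 M F F[1+M]≈0 = ≈-trans (⊕-cong ≈-refl F[1+M]≈0) (⊕-identityʳ _)

∑-at : ∀ M F N → (∑ M F) N +ℤ F 0 N ≡ sumTo M (λ j → F j N)
∑-at zero    F N = ℤP.+-identityˡ (F 0 N)
∑-at (suc M) F N = begin
    (∑ M F ⊕ F (suc M)) N +ℤ F 0 N
  ≡⟨ cong (_+ℤ F 0 N) (⊕-at (∑ M F) (F (suc M)) N) ⟩
    ∑ M F N +ℤ F (suc M) N +ℤ F 0 N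
  ≡⟨ swap (∑ M F N) (F (suc M) N) (F 0 N) ⟩
    ∑ M F N +ℤ F 0 N +ℤ F (suc M) N
  ≡⟨ cong (_+ℤ F (suc M) N) (∑-at M F N) ⟩
    sumTo (suc M) (λ j → F j N)
  ∎
  where
  open ≡-Reasoning
  swap : ∀ a b c → a +ℤ b +ℤ c ≡ a +ℤ c +ℤ b
  swap a b c = trans (ℤP.+-assoc a b c) (trans (cong (a +ℤ_) (ℤP.+-comm b c)) (sym (ℤP.+-assoc a c b)))

-- A finite form of Jacobi's triple product identity

Q : ℕ → Series
Q = fTo 2

q^odd : ℕ → Series
q^odd n = q^ suc (2 * n)

-- c n j is the coefficient of z^j, and of z^-j, in ∏_{k=1}^{n} (1 + z q^{2k-1})(1 + z⁻¹ q^{2k-1});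
-- the recursion multiplies by the next factor (1 + q^{4n+2}) + q^{2n+1} (z + z⁻¹).
c : ℕ → ℕ → Series
c zero    zero    = one
c zero    (suc j) = 𝟘
c (suc n) zero    = (one ⊕ q^odd n ⊗ q^odd n) ⊗ c n 0 ⊕ ι (+ 2) ⊗ (q^odd n ⊗ c n 1)
c (suc n) (suc j) = (one ⊕ q^odd n ⊗ q^odd n) ⊗ c n (suc j) ⊕ q^odd n ⊗ (c n j ⊕ c n (suc (suc j)))

c-vanishes : ∀ n j → n < j → c n j ≈ 𝟘
c-vanishes zero    (suc j) _         = ≈-refl
c-vanishes (suc n) (suc j) (s≤s n<j) = begin
    P ⊗ c n (suc j) ⊕ q^odd n ⊗ (c n j ⊕ c n (suc (suc j)))
  ≈⟨ ⊕-cong (⊗-cong ≈-refl (c-vanishes n (suc j) (ℕP.m≤n⇒m≤1+n n<j)))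
            (⊗-cong ≈-refl (⊕-cong (c-vanishes n j n<j) (c-vanishes n (suc (suc j)) (ℕP.m≤n⇒m≤1+n (ℕP.m≤n⇒m≤1+n n<j))))) ⟩
    P ⊗ 𝟘 ⊕ q^odd n ⊗ (𝟘 ⊕ 𝟘)
  ≈⟨ ⊕-cong (⊗-zeroʳ P) (≈-trans (⊗-cong ≈-refl (⊕-identityʳ 𝟘)) (⊗-zeroʳ (q^odd n))) ⟩
    𝟘 ⊕ 𝟘
  ≈⟨ ⊕-identityʳ 𝟘 ⟩
    𝟘
  ∎
  where
  open ≈-Reasoning
  P = one ⊕ q^odd n ⊗ q^odd n

-- c n j = q^{j²} times the q²-binomial coefficient [2n, n - j], cleared of denominators
JacobiAt : ℕ → Set
JacobiAt n = ∀ j r → j + r ≡ n → c n j ⊗ (Q (n + j) ⊗ Q r) ≈ q^ (j * j) ⊗ Q (n + n)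

Q-cong : ∀ {m k} → m ≡ k → Q m ≈ Q k
Q-cong refl = ≈-refl

module _ {c A B u S : Series} (X : Series) (cAB≈uS : c ⊗ (A ⊗ B) ≈ u ⊗ S) where

  absorbˡ : c ⊗ (X ⊗ A ⊗ B) ≈ (u ⊗ X) ⊗ S
  absorbˡ = ≈-trans (pull c X A B) (≈-trans (⊗-cong cAB≈uS ≈-refl) (swap u S X))
    where
    pull : ∀ c X A B → c ⊗ (X ⊗ A ⊗ B) ≈ (c ⊗ (A ⊗ B)) ⊗ X
    pull = solveˢ 4 (λ c X A B → c :* (X :* A :* B) := (c :* (A :* B)) :* X) ≈-refl
    swap : ∀ u S X → (u ⊗ S) ⊗ X ≈ (u ⊗ X) ⊗ S
    swap = solveˢ 3 (λ u S X → (u :* S) :* X := (u :* X) :* S) ≈-refl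

  absorbʳ : c ⊗ (A ⊗ (X ⊗ B)) ≈ (u ⊗ X) ⊗ S
  absorbʳ = ≈-trans (⊗-cong ≈-refl (commute A X B)) absorbˡ
    where
    commute : ∀ A X B → A ⊗ (X ⊗ B) ≈ X ⊗ A ⊗ B
    commute = solveˢ 3 (λ A X B → A :* (X :* B) := X :* A :* B) ≈-refl

vanishing : ∀ {c W u S} → c ≈ 𝟘 → c ⊗ W ≈ (u ⊗ oneMinus 0) ⊗ S
vanishing {c} {W} {u} {S} c≈0 = begin
    c ⊗ W         ≈⟨ ⊗-cong c≈0 ≈-refl ⟩
    𝟘 ⊗ W         ≈⟨ ⊗-zeroˡ W ⟩
    𝟘             ≈⟨ ⊗-zeroˡ S ⟨
    𝟘 ⊗ S         ≈⟨ ⊗-cong (⊗-zeroʳ u) ≈-refl ⟨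
    (u ⊗ 𝟘) ⊗ S   ≈⟨ ⊗-cong (⊗-cong ≈-refl oneMinus-0) ≈-refl ⟨
    (u ⊗ oneMinus 0) ⊗ S
  ∎
  where open ≈-Reasoning

-- The factor 1 - q^{2r} vanishes at r = 0, exactly where c n (suc j) does, so the shifted
-- statements need no boundary case.
module _ {n : ℕ} (J : JacobiAt n) where

  jacobi-shift₁ : ∀ j r → j + r ≡ n →
    c n (suc j) ⊗ (Q (n + suc j) ⊗ Q r) ≈ (q^ (suc j * suc j) ⊗ oneMinus (2 * r)) ⊗ Q (n + n)
  jacobi-shift₁ j zero    j+0≡n = vanishing (c-vanishes n (suc j) (s≤s (ℕP.≤-reflexive (trans (sym j+0≡n) (ℕP.+-identityʳ j)))))
  jacobi-shift₁ j (suc r) j+1+r≡n = absorbʳ (oneMinus (2 * suc r)) (J (suc j) r (trans (sym (ℕP.+-suc j r)) j+1+r≡n))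

  jacobi-shift₂ : ∀ j r → j + r ≡ n →
    c n (suc (suc j)) ⊗ (Q (n + suc (suc j)) ⊗ Q r)
      ≈ (q^ (suc (suc j) * suc (suc j)) ⊗ oneMinus (2 * (r ∸ 1)) ⊗ oneMinus (2 * r)) ⊗ Q (n + n)
  jacobi-shift₂ j zero    j+0≡n =
    vanishing (c-vanishes n (suc (suc j)) (s≤s (ℕP.m≤n⇒m≤1+n (ℕP.≤-reflexive (trans (sym j+0≡n) (ℕP.+-identityʳ j))))))
  jacobi-shift₂ j (suc r) j+1+r≡n =
    absorbʳ (oneMinus (2 * suc r)) (jacobi-shift₁ (suc j) r (trans (sym (ℕP.+-suc j r)) j+1+r≡n))

-- the recursion step for c (suc n) 0, with t = q^{2n} and x = q²
jacobi-identity₀ : ∀ {P Y X g q₁ Z₂ Z₁} t x →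
  P ≈ one ⊕ t ⊗ t ⊗ x → Y ≈ one ⊖ t ⊗ x → X ≈ one ⊖ t → g ⊗ q₁ ≈ t ⊗ x →
  Z₂ ≈ one ⊖ t ⊗ t ⊗ x ⊗ x → Z₁ ≈ one ⊖ t ⊗ t ⊗ x →
  P ⊗ ((one ⊗ Y) ⊗ Y) ⊕ ι (+ 2) ⊗ (g ⊗ ((q₁ ⊗ X) ⊗ Y)) ≈ (one ⊗ Z₂) ⊗ Z₁
jacobi-identity₀ {P} {Y} {X} {g} {q₁} {Z₂} {Z₁} t x hP hY hX hgq hZ₂ hZ₁ = begin
    P ⊗ ((one ⊗ Y) ⊗ Y) ⊕ ι (+ 2) ⊗ (g ⊗ ((q₁ ⊗ X) ⊗ Y))
  ≈⟨ regroup P Y X g q₁ ⟩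
    P ⊗ (Y ⊗ Y) ⊕ ι (+ 2) ⊗ ((g ⊗ q₁) ⊗ (X ⊗ Y))
  ≈⟨ ⊕-cong (⊗-cong hP (⊗-cong hY hY)) (⊗-cong ≈-refl (⊗-cong hgq (⊗-cong hX hY))) ⟩
    (one ⊕ t ⊗ t ⊗ x) ⊗ ((one ⊖ t ⊗ x) ⊗ (one ⊖ t ⊗ x))
      ⊕ ι (+ 2) ⊗ ((t ⊗ x) ⊗ ((one ⊖ t) ⊗ (one ⊖ t ⊗ x)))
  ≈⟨ identity t x ⟩
    (one ⊗ (one ⊖ t ⊗ t ⊗ x ⊗ x)) ⊗ (one ⊖ t ⊗ t ⊗ x)
  ≈⟨ ⊗-cong (⊗-cong ≈-refl hZ₂) hZ₁ ⟨
    (one ⊗ Z₂) ⊗ Z₁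
  ∎
  where
  open ≈-Reasoning
  regroup : ∀ P Y X g q₁ → P ⊗ ((one ⊗ Y) ⊗ Y) ⊕ ι (+ 2) ⊗ (g ⊗ ((q₁ ⊗ X) ⊗ Y))
                          ≈ P ⊗ (Y ⊗ Y) ⊕ ι (+ 2) ⊗ ((g ⊗ q₁) ⊗ (X ⊗ Y))
  regroup = solveˢ 5 (λ P Y X g q₁ → P :* ((con (+ 1) :* Y) :* Y) :+ con (+ 2) :* (g :* ((q₁ :* X) :* Y))
                                   := P :* (Y :* Y) :+ con (+ 2) :* ((g :* q₁) :* (X :* Y))) ≈-refl
  identity : ∀ t x → (one ⊕ t ⊗ t ⊗ x) ⊗ ((one ⊖ t ⊗ x) ⊗ (one ⊖ t ⊗ x))
                       ⊕ ι (+ 2) ⊗ ((t ⊗ x) ⊗ ((one ⊖ t) ⊗ (one ⊖ t ⊗ x)))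
                     ≈ (one ⊗ (one ⊖ t ⊗ t ⊗ x ⊗ x)) ⊗ (one ⊖ t ⊗ t ⊗ x)
  identity = solveˢ 2 (λ t x →
      (con (+ 1) :+ t :* t :* x) :* ((con (+ 1) :- t :* x) :* (con (+ 1) :- t :* x))
        :+ con (+ 2) :* ((t :* x) :* ((con (+ 1) :- t) :* (con (+ 1) :- t :* x)))
    := (con (+ 1) :* (con (+ 1) :- t :* t :* x :* x)) :* (con (+ 1) :- t :* t :* x)) ≈-refl

-- the recursion step for c (suc n) (suc j) when r = n - j ≥ 1, with a = q^{2(n+j+1)}, b = q^{2(r-1)}
-- and x = q²
jacobi-identity₁ : ∀ {P u v₀ v₂ g Y Y′ R₀ R₁ Z₂ Z₁} a b x →
  P ≈ one ⊕ a ⊗ b ⊗ x → Y ≈ one ⊖ a ⊗ x → Y′ ≈ one ⊖ a → R₁ ≈ one ⊖ b ⊗ x → R₀ ≈ one ⊖ b →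
  g ⊗ v₀ ≈ u ⊗ b ⊗ x → g ⊗ v₂ ≈ u ⊗ a ⊗ x →
  Z₂ ≈ one ⊖ a ⊗ b ⊗ x ⊗ x → Z₁ ≈ one ⊖ a ⊗ b ⊗ x →
  P ⊗ ((u ⊗ R₁) ⊗ Y) ⊕ g ⊗ ((v₀ ⊗ Y′) ⊗ Y ⊕ (v₂ ⊗ R₀) ⊗ R₁) ≈ (u ⊗ Z₂) ⊗ Z₁
jacobi-identity₁ {P} {u} {v₀} {v₂} {g} {Y} {Y′} {R₀} {R₁} {Z₂} {Z₁} a b x
                 hP hY hY′ hR₁ hR₀ hgv₀ hgv₂ hZ₂ hZ₁ = begin
    P ⊗ ((u ⊗ R₁) ⊗ Y) ⊕ g ⊗ ((v₀ ⊗ Y′) ⊗ Y ⊕ (v₂ ⊗ R₀) ⊗ R₁)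
  ≈⟨ regroup P u v₀ v₂ g Y Y′ R₀ R₁ ⟩
    P ⊗ ((u ⊗ R₁) ⊗ Y) ⊕ ((g ⊗ v₀) ⊗ (Y′ ⊗ Y) ⊕ (g ⊗ v₂) ⊗ (R₀ ⊗ R₁))
  ≈⟨ ⊕-cong (⊗-cong hP (⊗-cong (⊗-cong ≈-refl hR₁) hY))
            (⊕-cong (⊗-cong hgv₀ (⊗-cong hY′ hY)) (⊗-cong hgv₂ (⊗-cong hR₀ hR₁))) ⟩
    (one ⊕ a ⊗ b ⊗ x) ⊗ ((u ⊗ (one ⊖ b ⊗ x)) ⊗ (one ⊖ a ⊗ x))
      ⊕ ((u ⊗ b ⊗ x) ⊗ ((one ⊖ a) ⊗ (one ⊖ a ⊗ x)) ⊕ (u ⊗ a ⊗ x) ⊗ ((one ⊖ b) ⊗ (one ⊖ b ⊗ x)))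
  ≈⟨ identity a b x u ⟩
    (u ⊗ (one ⊖ a ⊗ b ⊗ x ⊗ x)) ⊗ (one ⊖ a ⊗ b ⊗ x)
  ≈⟨ ⊗-cong (⊗-cong ≈-refl hZ₂) hZ₁ ⟨
    (u ⊗ Z₂) ⊗ Z₁
  ∎
  where
  open ≈-Reasoning
  regroup : ∀ P u v₀ v₂ g Y Y′ R₀ R₁ →
    P ⊗ ((u ⊗ R₁) ⊗ Y) ⊕ g ⊗ ((v₀ ⊗ Y′) ⊗ Y ⊕ (v₂ ⊗ R₀) ⊗ R₁)
      ≈ P ⊗ ((u ⊗ R₁) ⊗ Y) ⊕ ((g ⊗ v₀) ⊗ (Y′ ⊗ Y) ⊕ (g ⊗ v₂) ⊗ (R₀ ⊗ R₁))
  regroup = solveˢ 9 (λ P u v₀ v₂ g Y Y′ R₀ R₁ →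
      P :* ((u :* R₁) :* Y) :+ g :* ((v₀ :* Y′) :* Y :+ (v₂ :* R₀) :* R₁)
    := P :* ((u :* R₁) :* Y) :+ ((g :* v₀) :* (Y′ :* Y) :+ (g :* v₂) :* (R₀ :* R₁))) ≈-refl
  identity : ∀ a b x u →
    (one ⊕ a ⊗ b ⊗ x) ⊗ ((u ⊗ (one ⊖ b ⊗ x)) ⊗ (one ⊖ a ⊗ x))
      ⊕ ((u ⊗ b ⊗ x) ⊗ ((one ⊖ a) ⊗ (one ⊖ a ⊗ x)) ⊕ (u ⊗ a ⊗ x) ⊗ ((one ⊖ b) ⊗ (one ⊖ b ⊗ x)))
      ≈ (u ⊗ (one ⊖ a ⊗ b ⊗ x ⊗ x)) ⊗ (one ⊖ a ⊗ b ⊗ x)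
  identity = solveˢ 4 (λ a b x u →
      (con (+ 1) :+ a :* b :* x) :* ((u :* (con (+ 1) :- b :* x)) :* (con (+ 1) :- a :* x))
        :+ ((u :* b :* x) :* ((con (+ 1) :- a) :* (con (+ 1) :- a :* x))
            :+ (u :* a :* x) :* ((con (+ 1) :- b) :* (con (+ 1) :- b :* x)))
    := (u :* (con (+ 1) :- a :* b :* x :* x)) :* (con (+ 1) :- a :* b :* x)) ≈-refl

-- the recursion step for c (suc n) (suc n), where only the middle term survives
jacobi-identity-top : ∀ {P u v₀ v₂ g Y Y′ R₀ Z₂ Z₁} →
  g ⊗ v₀ ≈ u → Y ≈ Z₂ → Y′ ≈ Z₁ →
  P ⊗ ((u ⊗ oneMinus 0) ⊗ Y) ⊕ g ⊗ ((v₀ ⊗ Y′) ⊗ Y ⊕ (v₂ ⊗ R₀) ⊗ oneMinus 0) ≈ (u ⊗ Z₂) ⊗ Z₁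
jacobi-identity-top {P} {u} {v₀} {v₂} {g} {Y} {Y′} {R₀} {Z₂} {Z₁} hgv₀ hY hY′ = begin
    P ⊗ ((u ⊗ oneMinus 0) ⊗ Y) ⊕ g ⊗ ((v₀ ⊗ Y′) ⊗ Y ⊕ (v₂ ⊗ R₀) ⊗ oneMinus 0)
  ≈⟨ ⊕-cong (⊗-cong ≈-refl (⊗-cong (⊗-cong ≈-refl oneMinus-0≈ι0) ≈-refl))
            (⊗-cong ≈-refl (⊕-cong ≈-refl (⊗-cong ≈-refl oneMinus-0≈ι0))) ⟩
    P ⊗ ((u ⊗ ι (+ 0)) ⊗ Y) ⊕ g ⊗ ((v₀ ⊗ Y′) ⊗ Y ⊕ (v₂ ⊗ R₀) ⊗ ι (+ 0))
  ≈⟨ drop P u v₀ v₂ g Y Y′ R₀ ⟩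
    ((g ⊗ v₀) ⊗ Y) ⊗ Y′
  ≈⟨ ⊗-cong (⊗-cong hgv₀ hY) hY′ ⟩
    (u ⊗ Z₂) ⊗ Z₁
  ∎
  where
  open ≈-Reasoning
  oneMinus-0≈ι0 : oneMinus 0 ≈ ι (+ 0)
  oneMinus-0≈ι0 = mk≈ λ { zero → refl ; (suc n) → refl }
  drop : ∀ P u v₀ v₂ g Y Y′ R₀ →
    P ⊗ ((u ⊗ ι (+ 0)) ⊗ Y) ⊕ g ⊗ ((v₀ ⊗ Y′) ⊗ Y ⊕ (v₂ ⊗ R₀) ⊗ ι (+ 0)) ≈ ((g ⊗ v₀) ⊗ Y) ⊗ Y′
  drop = solveˢ 8 (λ P u v₀ v₂ g Y Y′ R₀ →
      P :* ((u :* con (+ 0)) :* Y) :+ g :* ((v₀ :* Y′) :* Y :+ (v₂ :* R₀) :* con (+ 0))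
    := ((g :* v₀) :* Y) :* Y′) ≈-refl

module _ {P g W S : Series} where

  combine₀ : ∀ {c₀ c₁ u₀ u₁} → c₀ ⊗ W ≈ u₀ ⊗ S → c₁ ⊗ W ≈ u₁ ⊗ S →
    (P ⊗ c₀ ⊕ ι (+ 2) ⊗ (g ⊗ c₁)) ⊗ W ≈ (P ⊗ u₀ ⊕ ι (+ 2) ⊗ (g ⊗ u₁)) ⊗ S
  combine₀ {c₀} {c₁} {u₀} {u₁} h₀ h₁ = begin
      (P ⊗ c₀ ⊕ ι (+ 2) ⊗ (g ⊗ c₁)) ⊗ W
    ≈⟨ distrib P g c₀ c₁ W ⟩
      P ⊗ (c₀ ⊗ W) ⊕ ι (+ 2) ⊗ (g ⊗ (c₁ ⊗ W))
    ≈⟨ ⊕-cong (⊗-cong ≈-refl h₀) (⊗-cong ≈-refl (⊗-cong ≈-refl h₁)) ⟩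
      P ⊗ (u₀ ⊗ S) ⊕ ι (+ 2) ⊗ (g ⊗ (u₁ ⊗ S))
    ≈⟨ distrib P g u₀ u₁ S ⟨
      (P ⊗ u₀ ⊕ ι (+ 2) ⊗ (g ⊗ u₁)) ⊗ S
    ∎
    where
    open ≈-Reasoning
    distrib : ∀ P g c₀ c₁ W → (P ⊗ c₀ ⊕ ι (+ 2) ⊗ (g ⊗ c₁)) ⊗ W ≈ P ⊗ (c₀ ⊗ W) ⊕ ι (+ 2) ⊗ (g ⊗ (c₁ ⊗ W))
    distrib = solveˢ 5 (λ P g c₀ c₁ W →
      (P :* c₀ :+ con (+ 2) :* (g :* c₁)) :* W := P :* (c₀ :* W) :+ con (+ 2) :* (g :* (c₁ :* W))) ≈-refl

  combine₁ : ∀ {c₁ c₀ c₂ u₁ u₀ u₂} → c₁ ⊗ W ≈ u₁ ⊗ S → c₀ ⊗ W ≈ u₀ ⊗ S → c₂ ⊗ W ≈ u₂ ⊗ S →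
    (P ⊗ c₁ ⊕ g ⊗ (c₀ ⊕ c₂)) ⊗ W ≈ (P ⊗ u₁ ⊕ g ⊗ (u₀ ⊕ u₂)) ⊗ S
  combine₁ {c₁} {c₀} {c₂} {u₁} {u₀} {u₂} h₁ h₀ h₂ = begin
      (P ⊗ c₁ ⊕ g ⊗ (c₀ ⊕ c₂)) ⊗ W
    ≈⟨ distrib P g c₁ c₀ c₂ W ⟩
      P ⊗ (c₁ ⊗ W) ⊕ g ⊗ (c₀ ⊗ W ⊕ c₂ ⊗ W)
    ≈⟨ ⊕-cong (⊗-cong ≈-refl h₁) (⊗-cong ≈-refl (⊕-cong h₀ h₂)) ⟩
      P ⊗ (u₁ ⊗ S) ⊕ g ⊗ (u₀ ⊗ S ⊕ u₂ ⊗ S)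
    ≈⟨ distrib P g u₁ u₀ u₂ S ⟨
      (P ⊗ u₁ ⊕ g ⊗ (u₀ ⊕ u₂)) ⊗ S
    ∎
    where
    open ≈-Reasoning
    distrib : ∀ P g c₁ c₀ c₂ W → (P ⊗ c₁ ⊕ g ⊗ (c₀ ⊕ c₂)) ⊗ W ≈ P ⊗ (c₁ ⊗ W) ⊕ g ⊗ (c₀ ⊗ W ⊕ c₂ ⊗ W)
    distrib = solveˢ 6 (λ P g c₁ c₀ c₂ W →
      (P :* c₁ :+ g :* (c₀ :+ c₂)) :* W := P :* (c₁ :* W) :+ g :* (c₀ :* W :+ c₂ :* W)) ≈-refl

Q-suc-suc : ∀ n u → u ⊗ Q (suc n + suc n)
  ≈ ((u ⊗ oneMinus (2 * suc (suc (n + n)))) ⊗ oneMinus (2 * suc (n + n))) ⊗ Q (n + n)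
Q-suc-suc n u = ≈-trans (⊗-cong ≈-refl (Q-cong (cong suc (ℕP.+-suc n n)))) (reassociate u _ _ _)
  where
  reassociate : ∀ u A B C → u ⊗ (A ⊗ (B ⊗ C)) ≈ ((u ⊗ A) ⊗ B) ⊗ C
  reassociate = solveˢ 4 (λ u A B C → u :* (A :* (B :* C)) := ((u :* A) :* B) :* C) ≈-refl

jacobi-step-zero : ∀ n → JacobiAt n → c (suc n) 0 ⊗ (Q (suc n + 0) ⊗ Q (suc n)) ≈ q^ 0 ⊗ Q (suc n + suc n)
jacobi-step-zero n J = begin
    c (suc n) 0 ⊗ (Q (suc n + 0) ⊗ Q (suc n))
  ≈⟨ ⊗-cong ≈-refl (⊗-cong (Q-cong (ℕP.+-identityʳ (suc n))) ≈-refl) ⟩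
    c (suc n) 0 ⊗ (Y ⊗ Q n ⊗ (Y ⊗ Q n))
  ≈⟨ combine₀ T₀ T₁ ⟩
    (P ⊗ ((one ⊗ Y) ⊗ Y) ⊕ ι (+ 2) ⊗ (q^odd n ⊗ ((q^ 1 ⊗ oneMinus (2 * n)) ⊗ Y))) ⊗ Q (n + n)
  ≈⟨ ⊗-cong (jacobi-identity₀ t x hP hY (oneMinus≈ (2 * n)) hgq hZ₂ hZ₁) ≈-refl ⟩
    ((one ⊗ oneMinus (2 * suc (suc (n + n)))) ⊗ oneMinus (2 * suc (n + n))) ⊗ Q (n + n)
  ≈⟨ Q-suc-suc n one ⟨
    q^ 0 ⊗ Q (suc n + suc n)
  ∎
  where
  open ≈-Reasoning
  P Y t x : Series
  P = one ⊕ q^odd n ⊗ q^odd n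
  Y = oneMinus (2 * suc n)
  t = q^ (2 * n)
  x = q^ 2
  T₀ : c n 0 ⊗ (Y ⊗ Q n ⊗ (Y ⊗ Q n)) ≈ ((one ⊗ Y) ⊗ Y) ⊗ Q (n + n)
  T₀ = absorbʳ Y (absorbˡ Y (≈-trans (⊗-cong ≈-refl (⊗-cong (Q-cong (sym (ℕP.+-identityʳ n))) ≈-refl)) (J 0 n refl)))
  T₁ : c n 1 ⊗ (Y ⊗ Q n ⊗ (Y ⊗ Q n)) ≈ ((q^ 1 ⊗ oneMinus (2 * n)) ⊗ Y) ⊗ Q (n + n)
  T₁ = absorbʳ Y (≈-trans (⊗-cong ≈-refl (⊗-cong (Q-cong (ℕP.+-comm 1 n)) ≈-refl)) (jacobi-shift₁ J 0 n refl))
  hP : P ≈ one ⊕ t ⊗ t ⊗ x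
  hP = ⊕-cong ≈-refl (q^-⊗-q^ (q^≈₃ (2 * n) (2 * n) 2 (solve (n ∷ []))))
  hY : Y ≈ one ⊖ t ⊗ x
  hY = oneMinus-≈ (q^≈₂ (2 * n) 2 (solve (n ∷ [])))
  hgq : q^odd n ⊗ q^ 1 ≈ t ⊗ x
  hgq = q^-⊗-q^ (q^≈₂ (2 * n) 2 (solve (n ∷ [])))
  hZ₂ : oneMinus (2 * suc (suc (n + n))) ≈ one ⊖ t ⊗ t ⊗ x ⊗ x
  hZ₂ = oneMinus-≈ (q^≈₄ (2 * n) (2 * n) 2 2 (solve (n ∷ [])))
  hZ₁ : oneMinus (2 * suc (n + n)) ≈ one ⊖ t ⊗ t ⊗ x
  hZ₁ = oneMinus-≈ (q^≈₃ (2 * n) (2 * n) 2 (solve (n ∷ [])))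

jacobi-scalar-suc : ∀ n j r → j + r ≡ n →
  (one ⊕ q^odd n ⊗ q^odd n) ⊗ ((q^ (suc j * suc j) ⊗ oneMinus (2 * r)) ⊗ oneMinus (2 * suc (n + suc j)))
    ⊕ q^odd n ⊗ ((q^ (j * j) ⊗ oneMinus (2 * suc (n + j))) ⊗ oneMinus (2 * suc (n + suc j))
                 ⊕ (q^ (suc (suc j) * suc (suc j)) ⊗ oneMinus (2 * (r ∸ 1))) ⊗ oneMinus (2 * r))
    ≈ (q^ (suc j * suc j) ⊗ oneMinus (2 * suc (suc (n + n)))) ⊗ oneMinus (2 * suc (n + n))
jacobi-scalar-suc .(j + 0) j zero refl = jacobi-identity-top (q^-⊗-q^ (q^-≡ (solve (j ∷ [])))) hY hY′
  where
  hY : oneMinus (2 * suc (j + 0 + suc j)) ≈ oneMinus (2 * suc (suc (j + 0 + (j + 0))))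
  hY = ≡⇒≈ (cong oneMinus (solve (j ∷ [])))
  hY′ : oneMinus (2 * suc (j + 0 + j)) ≈ oneMinus (2 * suc (j + 0 + (j + 0)))
  hY′ = ≡⇒≈ (cong oneMinus (solve (j ∷ [])))
jacobi-scalar-suc .(j + suc s) j (suc s) refl = jacobi-identity₁ a b x
  (⊕-cong ≈-refl (q^-⊗-q^ (q^≈₃ (2 * suc (j + suc s + j)) (2 * s) 2 (solve (j ∷ s ∷ [])))))
  (oneMinus-≈ (q^≈₂ (2 * suc (j + suc s + j)) 2 (solve (j ∷ s ∷ []))))
  (oneMinus≈ (2 * suc (j + suc s + j)))
  (oneMinus-≈ (q^≈₂ (2 * s) 2 (solve (s ∷ []))))
  (oneMinus≈ (2 * s))
  (q^-⊗-q^ (q^≈₃ (suc j * suc j) (2 * s) 2 (solve (j ∷ s ∷ []))))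
  (q^-⊗-q^ (q^≈₃ (suc j * suc j) (2 * suc (j + suc s + j)) 2 (solve (j ∷ s ∷ []))))
  (oneMinus-≈ (q^≈₄ (2 * suc (j + suc s + j)) (2 * s) 2 2 (solve (j ∷ s ∷ []))))
  (oneMinus-≈ (q^≈₃ (2 * suc (j + suc s + j)) (2 * s) 2 (solve (j ∷ s ∷ []))))
  where
  a b x : Series
  a = q^ (2 * suc (j + suc s + j))
  b = q^ (2 * s)
  x = q^ 2

jacobi-step-suc : ∀ n j r → j + r ≡ n → JacobiAt n →
  c (suc n) (suc j) ⊗ (Q (suc n + suc j) ⊗ Q r) ≈ q^ (suc j * suc j) ⊗ Q (suc n + suc n)
jacobi-step-suc n j r j+r≡n J = begin
    c (suc n) (suc j) ⊗ (Q (suc n + suc j) ⊗ Q r)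
  ≈⟨ combine₁ T₁ T₀ T₂ ⟩
    _
  ≈⟨ ⊗-cong (jacobi-scalar-suc n j r j+r≡n) ≈-refl ⟩
    ((q^ (suc j * suc j) ⊗ oneMinus (2 * suc (suc (n + n)))) ⊗ oneMinus (2 * suc (n + n))) ⊗ Q (n + n)
  ≈⟨ Q-suc-suc n _ ⟨
    q^ (suc j * suc j) ⊗ Q (suc n + suc n)
  ∎
  where
  open ≈-Reasoning
  Y : Series
  Y = oneMinus (2 * suc (n + suc j))
  T₁ : c n (suc j) ⊗ (Q (suc n + suc j) ⊗ Q r) ≈ ((q^ (suc j * suc j) ⊗ oneMinus (2 * r)) ⊗ Y) ⊗ Q (n + n)
  T₁ = absorbˡ Y (jacobi-shift₁ J j r j+r≡n)
  T₀ : c n j ⊗ (Q (suc n + suc j) ⊗ Q r) ≈ ((q^ (j * j) ⊗ oneMinus (2 * suc (n + j))) ⊗ Y) ⊗ Q (n + n)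
  T₀ = absorbˡ Y (≈-trans (⊗-cong ≈-refl (⊗-cong (Q-cong (ℕP.+-suc n j)) ≈-refl))
                          (absorbˡ (oneMinus (2 * suc (n + j))) (J j r j+r≡n)))
  T₂ : c n (suc (suc j)) ⊗ (Q (suc n + suc j) ⊗ Q r)
         ≈ ((q^ (suc (suc j) * suc (suc j)) ⊗ oneMinus (2 * (r ∸ 1))) ⊗ oneMinus (2 * r)) ⊗ Q (n + n)
  T₂ = ≈-trans (⊗-cong ≈-refl (⊗-cong (Q-cong (sym (ℕP.+-suc n (suc j)))) ≈-refl)) (jacobi-shift₂ J j r j+r≡n)

jacobi-finite : ∀ n → JacobiAt n
jacobi-finite zero    zero    .zero    refl = ⊗-cong ≈-refl (⊗-identityˡ one)
jacobi-finite (suc n) zero    .(suc n) refl = jacobi-step-zero n (jacobi-finite n)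
jacobi-finite (suc n) (suc j) r        eq   = jacobi-step-suc n j r (ℕP.suc-injective eq) (jacobi-finite n)

Q-tail : ∀ a d → ∏ d (λ i → oneMinus (2 * (i + a))) ≈ one [q^ 2 * suc a ]
Q-tail a d = ∏-≈one[q^] d λ k →
  ≈[q^]-weaken (ℕP.*-monoʳ-≤ 2 (s≤s (ℕP.m≤n+m a k))) (oneMinus-≈[q^] (2 * (suc k + a)))

2[j+r]+1≤j²+2[1+r] : ∀ j r → suc (2 * (j + r)) ≤ j * j + 2 * suc r
2[j+r]+1≤j²+2[1+r] zero    r = ℕP.≤-trans (ℕP.n≤1+n _) (ℕP.≤-reflexive (solve (r ∷ [])))
2[j+r]+1≤j²+2[1+r] (suc j) r = ℕP.≤-trans (ℕP.m≤m+n _ (j * j)) (ℕP.≤-reflexive (solve (j ∷ r ∷ [])))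

jacobi-limit : ∀ n j → j ≤ n → c n j ⊗ Q n ≈ q^ (j * j) [q^ suc (2 * n) ]
jacobi-limit n j j≤n = ≈[q^]-trans (≈[q^]-weaken 1+2n≤2[1+n] append-X) (≈-≈[q^] exact drop-Y)
  where
  open ≈-Reasoning
  r : ℕ
  r = n ∸ j
  j+r≡n : j + r ≡ n
  j+r≡n = ℕP.m+[n∸m]≡n j≤n
  X Y Q⁻¹ : Series
  X = ∏ j (λ i → oneMinus (2 * (i + n)))
  Y = ∏ (n + j) (λ i → oneMinus (2 * (i + r)))
  Q⁻¹ = fInvTo 2 r
  1+2n≤2[1+n] : suc (2 * n) ≤ 2 * suc n
  1+2n≤2[1+n] = ℕP.≤-trans (ℕP.n≤1+n _) (ℕP.≤-reflexive (solve (n ∷ [])))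
  append-X : c n j ⊗ Q n ≈ c n j ⊗ Q n ⊗ X [q^ 2 * suc n ]
  append-X = ≈-≈[q^] (≈-sym (⊗-identityʳ _)) (⊗-cong[q^] ≈[q^]-refl (≈[q^]-sym (Q-tail n j)))
  regroup₁ : ∀ c A X B Q⁻¹ → c ⊗ A ⊗ X ⊗ (B ⊗ Q⁻¹) ≈ (c ⊗ (X ⊗ A ⊗ B)) ⊗ Q⁻¹
  regroup₁ = solveˢ 5 (λ c A X B Q⁻¹ → c :* A :* X :* (B :* Q⁻¹) := (c :* (X :* A :* B)) :* Q⁻¹) ≈-refl
  regroup₂ : ∀ u Y B Q⁻¹ → (u ⊗ (Y ⊗ B)) ⊗ Q⁻¹ ≈ (u ⊗ Y) ⊗ (B ⊗ Q⁻¹)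
  regroup₂ = solveˢ 4 (λ u Y B Q⁻¹ → (u :* (Y :* B)) :* Q⁻¹ := (u :* Y) :* (B :* Q⁻¹)) ≈-refl
  exact : c n j ⊗ Q n ⊗ X ≈ q^ (j * j) ⊗ Y
  exact = begin
      c n j ⊗ Q n ⊗ X
    ≈⟨ ⊗-identityʳ _ ⟨
      c n j ⊗ Q n ⊗ X ⊗ one
    ≈⟨ ⊗-cong ≈-refl (fTo-⊗-fInvTo 2 r) ⟨
      c n j ⊗ Q n ⊗ X ⊗ (Q r ⊗ Q⁻¹)
    ≈⟨ regroup₁ (c n j) (Q n) X (Q r) Q⁻¹ ⟩
      (c n j ⊗ (X ⊗ Q n ⊗ Q r)) ⊗ Q⁻¹
    ≈⟨ ⊗-cong (⊗-cong ≈-refl (⊗-cong (≈-trans (≈-sym (∏-+ j n (λ k → oneMinus (2 * k)))) (Q-cong (ℕP.+-comm j n))) ≈-refl)) ≈-refl ⟩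
      (c n j ⊗ (Q (n + j) ⊗ Q r)) ⊗ Q⁻¹
    ≈⟨ ⊗-cong (jacobi-finite n j r j+r≡n) ≈-refl ⟩
      (q^ (j * j) ⊗ Q (n + n)) ⊗ Q⁻¹
    ≈⟨ ⊗-cong (⊗-cong ≈-refl (≈-trans (Q-cong n+n≡n+j+r) (∏-+ (n + j) r (λ k → oneMinus (2 * k))))) ≈-refl ⟩
      (q^ (j * j) ⊗ (Y ⊗ Q r)) ⊗ Q⁻¹
    ≈⟨ regroup₂ (q^ (j * j)) Y (Q r) Q⁻¹ ⟩
      (q^ (j * j) ⊗ Y) ⊗ (Q r ⊗ Q⁻¹)
    ≈⟨ ⊗-cong ≈-refl (fTo-⊗-fInvTo 2 r) ⟩
      (q^ (j * j) ⊗ Y) ⊗ one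
    ≈⟨ ⊗-identityʳ _ ⟩
      q^ (j * j) ⊗ Y
    ∎
    where
    n+n≡n+j+r : n + n ≡ n + j + r
    n+n≡n+j+r = trans (cong (λ m → n + m) (sym j+r≡n)) (sym (ℕP.+-assoc n j r))
  drop-Y : q^ (j * j) ⊗ Y ≈ q^ (j * j) [q^ suc (2 * n) ]
  drop-Y = ≈[q^]-weaken (subst (λ m → suc (2 * m) ≤ j * j + 2 * suc r) j+r≡n (2[j+r]+1≤j²+2[1+r] j r))
                        (q^-⊗-≈[q^] (j * j) (Q-tail r (n + j)))

-- The product formula for φ

-- the product ∏_{k=1}^{n} (1 + z q^{2k-1})(1 + z⁻¹ q^{2k-1}) evaluated at z = 1
E : ℕ → Series
E n = c n 0 ⊕ ι (+ 2) ⊗ ∑ n (c n)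

E-suc : ∀ n → E (suc n) ≈ (one ⊕ q^odd n) ⊗ (one ⊕ q^odd n) ⊗ E n
E-suc n = ≈-trans (⊕-cong ≈-refl (⊗-cong ≈-refl sum-suc)) (identity (q^odd n) (c n 0) (c n 1) S)
  where
  g S : Series
  g = q^odd n
  S = ∑ n (c n)
  identity : ∀ g c₀ c₁ S →
    (one ⊕ g ⊗ g) ⊗ c₀ ⊕ ι (+ 2) ⊗ (g ⊗ c₁) ⊕ ι (+ 2) ⊗ ((one ⊕ g ⊗ g) ⊗ S ⊕ g ⊗ ((c₀ ⊕ S) ⊕ (S ⊖ c₁)))
      ≈ (one ⊕ g) ⊗ (one ⊕ g) ⊗ (c₀ ⊕ ι (+ 2) ⊗ S)
  identity = solveˢ 4 (λ g c₀ c₁ S →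
      (con (+ 1) :+ g :* g) :* c₀ :+ con (+ 2) :* (g :* c₁)
        :+ con (+ 2) :* ((con (+ 1) :+ g :* g) :* S :+ g :* ((c₀ :+ S) :+ (S :- c₁)))
    := (con (+ 1) :+ g) :* (con (+ 1) :+ g) :* (c₀ :+ con (+ 2) :* S)) ≈-refl
  same : ∑ (suc n) (c n) ≈ S
  same = ∑-last-𝟘 n (c n) (c-vanishes n (suc n) ℕP.≤-refl)
  lower : ∑ (suc n) (λ j → c n (j ∸ 1)) ≈ c n 0 ⊕ S
  lower = ∑-pred n (c n)
  upper : ∑ (suc n) (c n ∘ suc) ≈ S ⊖ c n 1
  upper = begin
      ∑ (suc n) (c n ∘ suc)
    ≈⟨ add-sub _ (c n 1) ⟩
      (∑ (suc n) (c n ∘ suc) ⊕ c n 1) ⊖ c n 1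
    ≈⟨ ⊕-cong (∑-suc (suc n) (c n)) ≈-refl ⟩
      ∑ (suc (suc n)) (c n) ⊖ c n 1
    ≈⟨ ⊕-cong (≈-trans (∑-last-𝟘 (suc n) (c n) (c-vanishes n (suc (suc n)) (ℕP.n≤1+n (suc n)))) same) ≈-refl ⟩
      S ⊖ c n 1
    ∎
    where
    open ≈-Reasoning
    add-sub : ∀ a b → a ≈ (a ⊕ b) ⊖ b
    add-sub = solveˢ 2 (λ a b → a := (a :+ b) :- b) ≈-refl
  sum-suc : ∑ (suc n) (c (suc n)) ≈ (one ⊕ g ⊗ g) ⊗ S ⊕ g ⊗ ((c n 0 ⊕ S) ⊕ (S ⊖ c n 1))
  sum-suc = begin
      ∑ (suc n) (c (suc n))
    ≈⟨ ∑-cong (suc n) {G = λ j → (one ⊕ g ⊗ g) ⊗ c n j ⊕ g ⊗ (c n (j ∸ 1) ⊕ c n (suc j))} (λ _ → ≈-refl) ⟩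
      ∑ (suc n) (λ j → (one ⊕ g ⊗ g) ⊗ c n j ⊕ g ⊗ (c n (j ∸ 1) ⊕ c n (suc j)))
    ≈⟨ ∑-⊕ (suc n) _ _ ⟩
      ∑ (suc n) (λ j → (one ⊕ g ⊗ g) ⊗ c n j) ⊕ ∑ (suc n) (λ j → g ⊗ (c n (j ∸ 1) ⊕ c n (suc j)))
    ≈⟨ ⊕-cong (∑-⊗ˡ (suc n) _ _) (≈-trans (∑-⊗ˡ (suc n) g _) (⊗-cong ≈-refl (∑-⊕ (suc n) _ _))) ⟩
      (one ⊕ g ⊗ g) ⊗ ∑ (suc n) (c n) ⊕ g ⊗ (∑ (suc n) (λ j → c n (j ∸ 1)) ⊕ ∑ (suc n) (c n ∘ suc))
    ≈⟨ ⊕-cong (⊗-cong ≈-refl same) (⊗-cong ≈-refl (⊕-cong lower upper)) ⟩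
      (one ⊕ g ⊗ g) ⊗ S ⊕ g ⊗ ((c n 0 ⊕ S) ⊕ (S ⊖ c n 1))
    ∎
    where open ≈-Reasoning

oddFactor : ℕ → Series
oddFactor k = (one ⊕ q^odd (k ∸ 1)) ⊗ (one ⊕ q^odd (k ∸ 1))

E≈∏ : ∀ n → E n ≈ ∏ n oddFactor
E≈∏ zero    = ≈-trans (⊕-cong ≈-refl (⊗-zeroʳ _)) (⊕-identityʳ one)
E≈∏ (suc n) = ≈-trans (E-suc n) (⊗-cong ≈-refl (E≈∏ n))

-- θ n = Σ_{|j| ≤ n} q^{j²}
θ : ℕ → Series
θ n = one ⊕ ι (+ 2) ⊗ ∑ n (λ j → q^ (j * j))

E-⊗-Q : ∀ n → E n ⊗ Q n ≈ θ n [q^ suc (2 * n) ]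
E-⊗-Q n = ≈-≈[q^] (distrib (c n 0) (∑ n (c n)) (Q n))
  (⊕-cong[q^] (jacobi-limit n 0 z≤n)
              (⊗-cong[q^] ≈[q^]-refl (≈-≈[q^] (≈-sym (∑-⊗ʳ n (Q n) (c n)))
                                              (∑-cong[q^] n λ j j<n → jacobi-limit n (suc j) j<n))))
  where
  distrib : ∀ c₀ S Q → (c₀ ⊕ ι (+ 2) ⊗ S) ⊗ Q ≈ c₀ ⊗ Q ⊕ ι (+ 2) ⊗ (S ⊗ Q)
  distrib = solveˢ 3 (λ c₀ S Q → (c₀ :+ con (+ 2) :* S) :* Q := c₀ :* Q :+ con (+ 2) :* (S :* Q)) ≈-refl

1+2m≤[1+d+m]² : ∀ d m → suc (2 * m) ≤ suc (d + m) * suc (d + m)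
1+2m≤[1+d+m]² d m = ℕP.≤-trans (s≤s (ℕP.*-monoʳ-≤ 2 (ℕP.m≤n+m m d)))
  (ℕP.≤-trans (ℕP.m≤n+m (suc (2 * (d + m))) ((d + m) * (d + m))) (ℕP.≤-reflexive square))
  where
  square : (d + m) * (d + m) + suc (2 * (d + m)) ≡ suc (d + m) * suc (d + m)
  square = solve (d ∷ m ∷ [])

θ-stable : ∀ m d → θ (d + m) ≈ θ m [q^ suc (2 * m) ]
θ-stable m zero    = ≈[q^]-refl
θ-stable m (suc d) = ≈[q^]-trans
  (⊕-cong[q^] ≈[q^]-refl (⊗-cong[q^] ≈[q^]-refl
    (≈[q^]-≈ (⊕-cong[q^] ≈[q^]-refl (≈[q^]-weaken (1+2m≤[1+d+m]² d m) (q^-≈𝟘 _))) (⊕-identityʳ _))))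
  (θ-stable m d)

-- φ(q) = Σ_{j ∈ ℤ} q^{j²}
phi : Series
phi = diagonal θ

phi-≈-θ : ∀ n → phi ≈ θ n [q^ suc (2 * n) ]
phi-≈-θ = diagonal-≈ θ (λ m → suc (2 * m)) (λ N → s≤s (ℕP.m≤m+n N (N + 0))) θ-stable

factor-identity : ∀ k →
  oddFactor (suc k) ⊗ oneMinus (2 * suc k)
    ⊗ ((oneMinus (1 * (suc k + suc k ∸ 1)) ⊗ oneMinus (1 * (suc k + suc k)))
       ⊗ (oneMinus (1 * (suc k + suc k ∸ 1)) ⊗ oneMinus (1 * (suc k + suc k))))
    ⊗ (oneMinus (4 * suc k) ⊗ oneMinus (4 * suc k))
  ≈ (oneMinus (2 * (suc k + suc k ∸ 1)) ⊗ oneMinus (2 * (suc k + suc k)))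
      ⊗ (oneMinus (2 * (suc k + suc k ∸ 1)) ⊗ oneMinus (2 * (suc k + suc k)))
    ⊗ (oneMinus (2 * suc k) ⊗ oneMinus (2 * suc k) ⊗ oneMinus (2 * suc k))
factor-identity k = begin
    _
  ≈⟨ ⊗-cong (⊗-cong (⊗-cong ≈-refl hz) (⊗-cong (⊗-cong hy hz′) (⊗-cong hy hz′))) (⊗-cong hw hw) ⟩
    (one ⊕ y) ⊗ (one ⊕ y) ⊗ (one ⊖ z) ⊗ ((one ⊖ y) ⊗ (one ⊖ z) ⊗ ((one ⊖ y) ⊗ (one ⊖ z)))
      ⊗ ((one ⊖ w) ⊗ (one ⊖ w))
  ≈⟨ identity y z w ⟩
    (one ⊖ y ⊗ y) ⊗ (one ⊖ w) ⊗ ((one ⊖ y ⊗ y) ⊗ (one ⊖ w)) ⊗ ((one ⊖ z) ⊗ (one ⊖ z) ⊗ (one ⊖ z))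
  ≈⟨ ⊗-cong (⊗-cong (⊗-cong hy² hw′) (⊗-cong hy² hw′)) (⊗-cong (⊗-cong hz hz) hz) ⟨
    _
  ∎
  where
  open ≈-Reasoning
  y z w : Series
  y = q^odd k
  z = q^ (2 * suc k)
  w = q^ (4 * suc k)
  hy : oneMinus (1 * (suc k + suc k ∸ 1)) ≈ one ⊖ y
  hy = oneMinus-≈ (q^-≡ odd)
    where
    odd : 1 * (k + suc k) ≡ suc (2 * k)
    odd = solve (k ∷ [])
  hz : oneMinus (2 * suc k) ≈ one ⊖ z
  hz = oneMinus≈ (2 * suc k)
  hz′ : oneMinus (1 * (suc k + suc k)) ≈ one ⊖ z
  hz′ = oneMinus-≈ (q^-≡ (solve (k ∷ [])))
  hw : oneMinus (4 * suc k) ≈ one ⊖ w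
  hw = oneMinus≈ (4 * suc k)
  hw′ : oneMinus (2 * (suc k + suc k)) ≈ one ⊖ w
  hw′ = oneMinus-≈ (q^-≡ (solve (k ∷ [])))
  hy² : oneMinus (2 * (suc k + suc k ∸ 1)) ≈ one ⊖ y ⊗ y
  hy² = oneMinus-≈ (q^≈₂ (suc (2 * k)) (suc (2 * k)) double-odd)
    where
    double-odd : 2 * (k + suc k) ≡ suc (2 * k) + suc (2 * k)
    double-odd = solve (k ∷ [])
  identity : ∀ y z w →
    (one ⊕ y) ⊗ (one ⊕ y) ⊗ (one ⊖ z) ⊗ ((one ⊖ y) ⊗ (one ⊖ z) ⊗ ((one ⊖ y) ⊗ (one ⊖ z)))
      ⊗ ((one ⊖ w) ⊗ (one ⊖ w))
    ≈ (one ⊖ y ⊗ y) ⊗ (one ⊖ w) ⊗ ((one ⊖ y ⊗ y) ⊗ (one ⊖ w)) ⊗ ((one ⊖ z) ⊗ (one ⊖ z) ⊗ (one ⊖ z))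
  identity = solveˢ 3 (λ y z w →
      (con (+ 1) :+ y) :* (con (+ 1) :+ y) :* (con (+ 1) :- z)
        :* ((con (+ 1) :- y) :* (con (+ 1) :- z) :* ((con (+ 1) :- y) :* (con (+ 1) :- z)))
        :* ((con (+ 1) :- w) :* (con (+ 1) :- w))
    := (con (+ 1) :- y :* y) :* (con (+ 1) :- w) :* ((con (+ 1) :- y :* y) :* (con (+ 1) :- w))
        :* ((con (+ 1) :- z) :* (con (+ 1) :- z) :* (con (+ 1) :- z))) ≈-refl

exact-product : ∀ n →
  ∏ n oddFactor ⊗ Q n ⊗ (fTo 1 (n + n) ⊗ fTo 1 (n + n)) ⊗ (fTo 4 n ⊗ fTo 4 n)
    ≈ Q (n + n) ⊗ Q (n + n) ⊗ (Q n ⊗ Q n ⊗ Q n)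
exact-product n = ≈-trans factorwiseˡ (≈-trans (∏-cong n factor-identity) (≈-sym factorwiseʳ))
  where
  split : ∀ h → fTo h (n + n) ≈ ∏ n (λ k → oneMinus (h * (k + k ∸ 1)) ⊗ oneMinus (h * (k + k)))
  split h = ∏-pairs n (λ k → oneMinus (h * k))
  factorwiseˡ : ∏ n oddFactor ⊗ Q n ⊗ (fTo 1 (n + n) ⊗ fTo 1 (n + n)) ⊗ (fTo 4 n ⊗ fTo 4 n) ≈ _
  factorwiseˡ = ≈-trans
    (⊗-cong (⊗-cong (∏-⊗ n _ _) (≈-trans (⊗-cong (split 1) (split 1)) (∏-⊗ n _ _))) (∏-⊗ n _ _))
    (≈-trans (⊗-cong (∏-⊗ n _ _) ≈-refl) (∏-⊗ n _ _))
  factorwiseʳ : Q (n + n) ⊗ Q (n + n) ⊗ (Q n ⊗ Q n ⊗ Q n) ≈ _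
  factorwiseʳ = ≈-trans
    (⊗-cong (≈-trans (⊗-cong (split 2) (split 2)) (∏-⊗ n _ _)) (≈-trans (⊗-cong (∏-⊗ n _ _) ≈-refl) (∏-⊗ n _ _)))
    (∏-⊗ n _ _)

phi-product : phi ⊗ (f 1 ⊗ f 1) ⊗ (f 4 ⊗ f 4) ≈ f 2 ⊗ f 2 ⊗ (f 2 ⊗ f 2 ⊗ f 2)
phi-product = mk≈ λ n → below (truncated n) n (s≤s (ℕP.m≤m+n n (n + 0)))
  where
  truncated : ∀ n → phi ⊗ (f 1 ⊗ f 1) ⊗ (f 4 ⊗ f 4) ≈ f 2 ⊗ f 2 ⊗ (f 2 ⊗ f 2 ⊗ f 2) [q^ suc (2 * n) ]
  truncated n = ≈[q^]-trans
    (⊗-cong[q^] (⊗-cong[q^] phi≈ (⊗-cong[q^] f₁≈ f₁≈)) (⊗-cong[q^] f₄≈ f₄≈))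
    (≈-≈[q^] (exact-product n) (≈[q^]-sym (⊗-cong[q^] (⊗-cong[q^] f₂≈ f₂≈) (⊗-cong[q^] (⊗-cong[q^] f₂≈′ f₂≈′) f₂≈′))))
    where
    phi≈ : phi ≈ ∏ n oddFactor ⊗ Q n [q^ suc (2 * n) ]
    phi≈ = ≈[q^]-trans (phi-≈-θ n) (≈[q^]-sym (≈-≈[q^] (⊗-cong (≈-sym (E≈∏ n)) ≈-refl) (E-⊗-Q n)))
    f₁≈ : f 1 ≈ fTo 1 (n + n) [q^ suc (2 * n) ]
    f₁≈ = ≈[q^]-weaken (ℕP.≤-reflexive D≡) (f-≈-fTo 1 (n + n))
      where
      D≡ : suc (2 * n) ≡ 1 * suc (n + n)
      D≡ = solve (n ∷ [])
    f₂≈ : f 2 ≈ fTo 2 (n + n) [q^ suc (2 * n) ]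
    f₂≈ = ≈[q^]-weaken (ℕP.≤-trans (ℕP.m≤m+n (suc (2 * n)) (suc (n + n))) (ℕP.≤-reflexive D+≡)) (f-≈-fTo 2 (n + n))
      where
      D+≡ : suc (2 * n) + suc (n + n) ≡ 2 * suc (n + n)
      D+≡ = solve (n ∷ [])
    f₂≈′ : f 2 ≈ fTo 2 n [q^ suc (2 * n) ]
    f₂≈′ = ≈[q^]-weaken (ℕP.≤-trans (ℕP.m≤m+n (suc (2 * n)) 1) (ℕP.≤-reflexive D+≡)) (f-≈-fTo 2 n)
      where
      D+≡ : suc (2 * n) + 1 ≡ 2 * suc n
      D+≡ = solve (n ∷ [])
    f₄≈ : f 4 ≈ fTo 4 n [q^ suc (2 * n) ]
    f₄≈ = ≈[q^]-weaken (ℕP.≤-trans (ℕP.m≤m+n (suc (2 * n)) (suc (2 * suc n))) (ℕP.≤-reflexive D+≡)) (f-≈-fTo 4 n)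
      where
      D+≡ : suc (2 * n) + suc (2 * suc n) ≡ 4 * suc n
      D+≡ = solve (n ∷ [])

-- Congruences between series

_⊗^_ : Series → ℕ → Series
a ⊗^ zero  = one
a ⊗^ suc k = a ⊗ a ⊗^ k

infixr 8 _⊗^_

pow≈⊗^ : ∀ a k → pow a k ≈ a ⊗^ k
pow≈⊗^ a zero    = ≈-refl
pow≈⊗^ a (suc k) = mk≈ λ n → trans
  (sumTo-cong n λ i _ → cong (a i *ℤ_) (at (pow≈⊗^ a k) (n ∸ i))) (sym (⊗-at a (a ⊗^ k) n))

⊗^-cong : ∀ {a b} k → a ≈ b → a ⊗^ k ≈ b ⊗^ k
⊗^-cong zero    a≈b = ≈-refl
⊗^-cong (suc k) a≈b = ⊗-cong a≈b (⊗^-cong k a≈b)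

⊗^-+ : ∀ a k l → a ⊗^ (k + l) ≈ a ⊗^ k ⊗ a ⊗^ l
⊗^-+ a zero    l = ≈-sym (⊗-identityˡ _)
⊗^-+ a (suc k) l = ≈-trans (⊗-cong ≈-refl (⊗^-+ a k l)) (≈-sym (⊗-assoc _ _ _))

⊗^-double : ∀ a k → a ⊗^ (2 * k) ≈ a ⊗^ k ⊗ a ⊗^ k
⊗^-double a k = ≈-trans (≡⇒≈ (cong (λ l → a ⊗^ (k + l)) (ℕP.+-identityʳ k))) (⊗^-+ a k k)

⊗^-distrib-⊗ : ∀ a b k → (a ⊗ b) ⊗^ k ≈ a ⊗^ k ⊗ b ⊗^ k
⊗^-distrib-⊗ a b zero    = ≈-sym (⊗-identityˡ one)
⊗^-distrib-⊗ a b (suc k) = ≈-trans (⊗-cong ≈-refl (⊗^-distrib-⊗ a b k)) (⊗-interchange a b _ _)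

one-⊗^ : ∀ k → one ⊗^ k ≈ one
one-⊗^ zero    = ≈-refl
one-⊗^ (suc k) = ≈-trans (⊗-identityˡ _) (one-⊗^ k)

infix 4 _≈_[mod_]

record _≈_[mod_] (a b : Series) (M : ℕ) : Set where
  constructor mk≈[mod]
  field
    quotient : Series
    ≈+multiple : a ≈ b ⊕ ι (+ M) ⊗ quotient
open _≈_[mod_] public

≈⇒≈[mod] : ∀ {a b M} → a ≈ b → a ≈ b [mod M ]
≈⇒≈[mod] {a} {b} {M} a≈b = mk≈[mod] 𝟘 (≈-trans a≈b (≈-sym (≈-trans (⊕-cong ≈-refl (⊗-zeroʳ _)) (⊕-identityʳ b))))

≈[mod]-trans : ∀ {a b c M} → a ≈ b [mod M ] → b ≈ c [mod M ] → a ≈ c [mod M ]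
≈[mod]-trans {a} {b} {c} {M} (mk≈[mod] s a≈b+Ms) (mk≈[mod] t b≈c+Mt) =
  mk≈[mod] (t ⊕ s) (≈-trans a≈b+Ms (≈-trans (⊕-cong b≈c+Mt ≈-refl) (collect c (ι (+ M)) t s)))
  where
  collect : ∀ c m t s → (c ⊕ m ⊗ t) ⊕ m ⊗ s ≈ c ⊕ m ⊗ (t ⊕ s)
  collect = solveˢ 4 (λ c m t s → (c :+ m :* t) :+ m :* s := c :+ m :* (t :+ s)) ≈-refl

≈[mod]-sym : ∀ {a b M} → a ≈ b [mod M ] → b ≈ a [mod M ]
≈[mod]-sym {a} {b} {M} (mk≈[mod] s a≈b+Ms) =
  mk≈[mod] (⊖ s) (≈-trans (add-sub b (ι (+ M)) s) (⊕-cong (≈-sym a≈b+Ms) ≈-refl))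
  where
  add-sub : ∀ b m s → b ≈ (b ⊕ m ⊗ s) ⊕ m ⊗ (⊖ s)
  add-sub = solveˢ 3 (λ b m s → b := (b :+ m :* s) :+ m :* (:- s)) ≈-refl

⊗-cong[mod] : ∀ {a a′ b b′ M} → a ≈ a′ [mod M ] → b ≈ b′ [mod M ] → a ⊗ b ≈ a′ ⊗ b′ [mod M ]
⊗-cong[mod] {a} {a′} {b} {b′} {M} (mk≈[mod] s a≈a′+Ms) (mk≈[mod] t b≈b′+Mt) =
  mk≈[mod] (a′ ⊗ t ⊕ s ⊗ b′ ⊕ ι (+ M) ⊗ (s ⊗ t))
    (≈-trans (⊗-cong a≈a′+Ms b≈b′+Mt) (expand a′ b′ (ι (+ M)) s t))
  where
  expand : ∀ a′ b′ m s t → (a′ ⊕ m ⊗ s) ⊗ (b′ ⊕ m ⊗ t) ≈ a′ ⊗ b′ ⊕ m ⊗ (a′ ⊗ t ⊕ s ⊗ b′ ⊕ m ⊗ (s ⊗ t))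
  expand = solveˢ 5 (λ a′ b′ m s t →
    (a′ :+ m :* s) :* (b′ :+ m :* t) := a′ :* b′ :+ m :* (a′ :* t :+ s :* b′ :+ m :* (s :* t))) ≈-refl

ι-* : ∀ k l → ι (+ (k * l)) ≈ ι (+ k) ⊗ ι (+ l)
ι-* k l = ≈-trans (≡⇒≈ (cong ι (ℤP.pos-* k l))) (_-Raw-AlmostCommutative⟶_.*-homo ι-morphism (+ k) (+ l))
  where open ACR using (_-Raw-AlmostCommutative⟶_)

square-[mod] : ∀ {a b} M → a ≈ b [mod 2 * M ] → a ⊗ a ≈ b ⊗ b [mod 4 * M ]
square-[mod] {a} {b} M (mk≈[mod] s a≈b+2Ms) = mk≈[mod] (b ⊗ s ⊕ ι (+ M) ⊗ (s ⊗ s)) $ begin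
    a ⊗ a
  ≈⟨ ⊗-cong a≈b+2Ms a≈b+2Ms ⟩
    (b ⊕ ι (+ (2 * M)) ⊗ s) ⊗ (b ⊕ ι (+ (2 * M)) ⊗ s)
  ≈⟨ ⊗-cong (⊕-cong ≈-refl (⊗-cong (ι-* 2 M) ≈-refl)) (⊕-cong ≈-refl (⊗-cong (ι-* 2 M) ≈-refl)) ⟩
    (b ⊕ ι (+ 2) ⊗ ι (+ M) ⊗ s) ⊗ (b ⊕ ι (+ 2) ⊗ ι (+ M) ⊗ s)
  ≈⟨ expand b (ι (+ M)) s ⟩
    b ⊗ b ⊕ ι (+ 4) ⊗ ι (+ M) ⊗ (b ⊗ s ⊕ ι (+ M) ⊗ (s ⊗ s))
  ≈⟨ ⊕-cong ≈-refl (⊗-cong (ι-* 4 M) ≈-refl) ⟨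
    b ⊗ b ⊕ ι (+ (4 * M)) ⊗ (b ⊗ s ⊕ ι (+ M) ⊗ (s ⊗ s))
  ∎
  where
  open ≈-Reasoning
  expand : ∀ b m s → (b ⊕ ι (+ 2) ⊗ m ⊗ s) ⊗ (b ⊕ ι (+ 2) ⊗ m ⊗ s) ≈ b ⊗ b ⊕ ι (+ 4) ⊗ m ⊗ (b ⊗ s ⊕ m ⊗ (s ⊗ s))
  expand = solveˢ 3 (λ b m s →
    (b :+ con (+ 2) :* m :* s) :* (b :+ con (+ 2) :* m :* s) := b :* b :+ con (+ 4) :* m :* (b :* s :+ m :* (s :* s))) ≈-refl

⊗^-2^-[mod] : ∀ {a b} k → a ≈ b [mod 2 ] → a ⊗^ (2 ^ k) ≈ b ⊗^ (2 ^ k) [mod 2 ^ suc k ]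
⊗^-2^-[mod] zero    a≡b = ⊗-cong[mod] a≡b (≈⇒≈[mod] ≈-refl)
⊗^-2^-[mod] {a} {b} (suc k) a≡b =
  ≈[mod]-trans (≈⇒≈[mod] (⊗^-double a (2 ^ k)))
    (≈[mod]-trans (subst (a ⊗^ (2 ^ k) ⊗ a ⊗^ (2 ^ k) ≈ b ⊗^ (2 ^ k) ⊗ b ⊗^ (2 ^ k) [mod_]) 4*2^k≡2^[2+k]
                                (square-[mod] (2 ^ k) (⊗^-2^-[mod] k a≡b)))
                  (≈⇒≈[mod] (≈-sym (⊗^-double b (2 ^ k)))))
  where
  4*2^k≡2^[2+k] : 4 * 2 ^ k ≡ 2 ^ suc (suc k)
  4*2^k≡2^[2+k] = ℕP.*-assoc 2 2 (2 ^ k)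

∏-cong[mod] : ∀ K {F G : ℕ → Series} {M} → (∀ k → F (suc k) ≈ G (suc k) [mod M ]) → ∏ K F ≈ ∏ K G [mod M ]
∏-cong[mod] zero    F≡G = ≈⇒≈[mod] ≈-refl
∏-cong[mod] (suc K) F≡G = ⊗-cong[mod] (F≡G K) (∏-cong[mod] K F≡G)

≈[mod]-limit : ∀ {a b M} (a′ b′ : ℕ → Series) → (∀ n → a ≈ a′ n [q^ suc n ]) → (∀ n → b ≈ b′ n [q^ suc n ]) →
  (∀ n → a′ n ≈ b′ n [mod M ]) → a ≈ b [mod M ]
≈[mod]-limit {a} {b} {M} a′ b′ a≈a′ b≈b′ a′≡b′ = mk≈[mod] (λ n → quotient (a′≡b′ n) n) (mk≈ λ n → begin
    a n
  ≡⟨ below (a≈a′ n) n ℕP.≤-refl ⟩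
    a′ n n
  ≡⟨ at (≈+multiple (a′≡b′ n)) n ⟩
    (b′ n ⊕ ι (+ M) ⊗ quotient (a′≡b′ n)) n
  ≡⟨ trans (⊕-at _ _ n) (cong₂ _+ℤ_ (sym (below (b≈b′ n) n ℕP.≤-refl)) (ι-⊗ (+ M) _ n)) ⟩
    b n +ℤ + M *ℤ quotient (a′≡b′ n) n
  ≡⟨ sym (trans (⊕-at b _ n) (cong (b n +ℤ_) (ι-⊗ (+ M) _ n))) ⟩
    (b ⊕ ι (+ M) ⊗ (λ n → quotient (a′≡b′ n) n)) n
  ∎)
  where open ≡-Reasoning

≈[mod]-at : ∀ {a b M} (a≡b : a ≈ b [mod M ]) n → a n ≡ b n +ℤ + M *ℤ quotient a≡b n
≈[mod]-at {a} {b} {M} a≡b n = trans (at (≈+multiple a≡b) n) (trans (⊕-at b _ n) (cong (b n +ℤ_) (ι-⊗ (+ M) _ n)))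

≡[mod]-intro : ∀ {a b} M t → a ≡ b +ℤ + M *ℤ t → a ≡ b [mod M ]
≡[mod]-intro {a} {b} M t a≡b+Mt = ℕ∣.divides ℤ.∣ t ∣ (begin
    ℤ.∣ a ℤ.- b ∣            ≡⟨ cong (λ x → ℤ.∣ x ℤ.- b ∣) a≡b+Mt ⟩
    ℤ.∣ b +ℤ + M *ℤ t ℤ.- b ∣ ≡⟨ cong ℤ.∣_∣ (cancel b (+ M *ℤ t)) ⟩
    ℤ.∣ + M *ℤ t ∣           ≡⟨ ℤP.abs-* (+ M) t ⟩
    M * ℤ.∣ t ∣              ≡⟨ ℕP.*-comm M _ ⟩
    ℤ.∣ t ∣ * M              ∎)
  where
  open ≡-Reasoning
  cancel : ∀ b x → b +ℤ x ℤ.- b ≡ x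
  cancel b x = trans (cong (_+ℤ - b) (ℤP.+-comm b x))
    (trans (ℤP.+-assoc x b (- b)) (trans (cong (x +ℤ_) (ℤP.+-inverseʳ b)) (ℤP.+-identityʳ x)))

-- factorwise, (1 - z)² = (1 - z²) + 2(z² - z)
frobenius : f 2 ⊗ f 2 ≈ f 4 [mod 2 ]
frobenius = ≈[mod]-limit (λ n → fTo 2 n ⊗ fTo 2 n) (fTo 4)
  (λ n → ≈[q^]-weaken (ℕP.m≤m+n (suc n) _) (⊗-cong[q^] (f-≈-fTo 2 n) (f-≈-fTo 2 n)))
  (λ n → ≈[q^]-weaken (ℕP.m≤m+n (suc n) _) (f-≈-fTo 4 n))
  (λ n → ≈[mod]-trans (≈⇒≈[mod] (∏-⊗ n _ _)) (∏-cong[mod] n square-factor))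
  where
  square-factor : ∀ k → oneMinus (2 * suc k) ⊗ oneMinus (2 * suc k) ≈ oneMinus (4 * suc k) [mod 2 ]
  square-factor k = mk≈[mod] (z ⊗ z ⊖ z) $ begin
      oneMinus (2 * suc k) ⊗ oneMinus (2 * suc k)
    ≈⟨ ⊗-cong (oneMinus≈ _) (oneMinus≈ _) ⟩
      (one ⊖ z) ⊗ (one ⊖ z)
    ≈⟨ identity z ⟩
      (one ⊖ z ⊗ z) ⊕ ι (+ 2) ⊗ (z ⊗ z ⊖ z)
    ≈⟨ ⊕-cong (oneMinus-≈ (q^≈₂ (2 * suc k) (2 * suc k) (solve (k ∷ [])))) ≈-refl ⟨
      oneMinus (4 * suc k) ⊕ ι (+ 2) ⊗ (z ⊗ z ⊖ z)
    ∎
    where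
    open ≈-Reasoning
    z : Series
    z = q^ (2 * suc k)
    identity : ∀ z → (one ⊖ z) ⊗ (one ⊖ z) ≈ (one ⊖ z ⊗ z) ⊕ ι (+ 2) ⊗ (z ⊗ z ⊖ z)
    identity = solveˢ 1 (λ z → (con (+ 1) :- z) :* (con (+ 1) :- z)
                            := (con (+ 1) :- z :* z) :+ con (+ 2) :* (z :* z :- z)) ≈-refl

f₄^-fInv₂^-[mod] : ∀ k → f 4 ⊗^ (2 ^ k) ⊗ fInv 2 ⊗^ (2 ^ suc k) ≈ one [mod 2 ^ suc k ]
f₄^-fInv₂^-[mod] k = ≈[mod]-trans
  (⊗-cong[mod] (≈[mod]-sym (⊗^-2^-[mod] k frobenius)) (≈⇒≈[mod] (⊗^-double i₂ N)))
  (≈⇒≈[mod] (begin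
      (f 2 ⊗ f 2) ⊗^ N ⊗ (i₂ ⊗^ N ⊗ i₂ ⊗^ N)
    ≈⟨ ⊗-cong (⊗^-distrib-⊗ (f 2) (f 2) N) ≈-refl ⟩
      f 2 ⊗^ N ⊗ f 2 ⊗^ N ⊗ (i₂ ⊗^ N ⊗ i₂ ⊗^ N)
    ≈⟨ ⊗-interchange _ _ _ _ ⟩
      f 2 ⊗^ N ⊗ i₂ ⊗^ N ⊗ (f 2 ⊗^ N ⊗ i₂ ⊗^ N)
    ≈⟨ ⊗-cong cancel cancel ⟩
      one ⊗ one
    ≈⟨ ⊗-identityˡ one ⟩
      one
    ∎))
  where
  open ≈-Reasoning
  N : ℕ
  N = 2 ^ k
  i₂ : Series
  i₂ = fInv 2
  cancel : f 2 ⊗^ N ⊗ i₂ ⊗^ N ≈ one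
  cancel = ≈-trans (≈-sym (⊗^-distrib-⊗ (f 2) i₂ N)) (≈-trans (⊗^-cong N (f-⊗-fInv 2)) (one-⊗^ N))

-- The generating function of ā_{8m+3} modulo 16

G : ℕ → Series
G m = f 4 ⊗^ (8 * m + 2) ⊗ (fInv 1 ⊗^ 2 ⊗ fInv 2 ⊗^ (16 * m + 3))

G-≡ : ∀ {k k′ l l′} → k ≡ k′ → l ≡ l′ →
  f 4 ⊗^ k ⊗ (fInv 1 ⊗^ 2 ⊗ fInv 2 ⊗^ l) ≈ f 4 ⊗^ k′ ⊗ (fInv 1 ⊗^ 2 ⊗ fInv 2 ⊗^ l′)
G-≡ refl refl = ≈-refl

abarSeries≈G : ∀ m → abarSeries (8 * m + 3) ≈ G m
abarSeries≈G m = begin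
    abarSeries (8 * m + 3)
  ≡⟨ cong abarSeries 8m+3≡ ⟩
    mul (pow (f 4) (suc (8 * m + 1))) (mul (pow (fInv 1) 2) (pow (fInv 2) (2 * (8 * m + 1) + 1)))
  ≈⟨ ≈-trans (mul≈⊗ (pow (f 4) (suc (8 * m + 1))) _) (⊗-cong (pow≈⊗^ (f 4) (suc (8 * m + 1)))
       (≈-trans (mul≈⊗ (pow (fInv 1) 2) _) (⊗-cong (pow≈⊗^ (fInv 1) 2) (pow≈⊗^ (fInv 2) (2 * (8 * m + 1) + 1))))) ⟩
    f 4 ⊗^ suc (8 * m + 1) ⊗ (fInv 1 ⊗^ 2 ⊗ fInv 2 ⊗^ (2 * (8 * m + 1) + 1))
  ≈⟨ G-≡ 1+e≡ 2e+1≡ ⟩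
    G m
  ∎
  where
  open ≈-Reasoning
  1+e≡ : suc (8 * m + 1) ≡ 8 * m + 2
  1+e≡ = solve (m ∷ [])
  2e+1≡ : 2 * (8 * m + 1) + 1 ≡ 16 * m + 3
  2e+1≡ = solve (m ∷ [])
  8m+3≡ : 8 * m + 3 ≡ suc (suc (8 * m + 1))
  8m+3≡ = solve (m ∷ [])
  mul≈⊗ : ∀ a b → mul a b ≈ a ⊗ b
  mul≈⊗ a b = mk≈ λ n → sym (⊗-at a b n)

G-suc : ∀ m → G (suc m) ≈ G m ⊗ (f 4 ⊗^ 8 ⊗ fInv 2 ⊗^ 16)
G-suc m = begin
    G (suc m)
  ≈⟨ G-≡ 8[1+m]+2≡ 16[1+m]+3≡ ⟩
    f 4 ⊗^ (8 + (8 * m + 2)) ⊗ (fInv 1 ⊗^ 2 ⊗ fInv 2 ⊗^ (16 + (16 * m + 3)))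
  ≈⟨ ⊗-cong (⊗^-+ (f 4) 8 (8 * m + 2)) (⊗-cong ≈-refl (⊗^-+ (fInv 2) 16 (16 * m + 3))) ⟩
    f 4 ⊗^ 8 ⊗ f 4 ⊗^ (8 * m + 2) ⊗ (fInv 1 ⊗^ 2 ⊗ (fInv 2 ⊗^ 16 ⊗ fInv 2 ⊗^ (16 * m + 3)))
  ≈⟨ regroup _ _ _ _ _ ⟩
    G m ⊗ (f 4 ⊗^ 8 ⊗ fInv 2 ⊗^ 16)
  ∎
  where
  open ≈-Reasoning
  8[1+m]+2≡ : 8 * suc m + 2 ≡ 8 + (8 * m + 2)
  8[1+m]+2≡ = solve (m ∷ [])
  16[1+m]+3≡ : 16 * suc m + 3 ≡ 16 + (16 * m + 3)
  16[1+m]+3≡ = solve (m ∷ [])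
  regroup : ∀ a₈ a b b₁₆ c → a₈ ⊗ a ⊗ (b ⊗ (b₁₆ ⊗ c)) ≈ a ⊗ (b ⊗ c) ⊗ (a₈ ⊗ b₁₆)
  regroup = solveˢ 5 (λ a₈ a b b₁₆ c → a₈ :* a :* (b :* (b₁₆ :* c)) := a :* (b :* c) :* (a₈ :* b₁₆)) ≈-refl

G≈G₀ : ∀ m → G m ≈ G 0 [mod 16 ]
G≈G₀ zero    = ≈⇒≈[mod] ≈-refl
G≈G₀ (suc m) = ≈[mod]-trans (≈⇒≈[mod] (G-suc m))
  (≈[mod]-trans (⊗-cong[mod] (G≈G₀ m) (f₄^-fInv₂^-[mod] 3)) (≈⇒≈[mod] (⊗-identityʳ (G 0))))

G₀≈phi⊗K : G 0 ≈ phi ⊗ (f 4 ⊗^ 4 ⊗ fInv 2 ⊗^ 8)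
G₀≈phi⊗K = ≈-sym (begin
    phi ⊗ (f 4 ⊗^ 4 ⊗ fInv 2 ⊗^ 8)
  ≈⟨ ⊗-identityʳ _ ⟨
    phi ⊗ (f 4 ⊗^ 4 ⊗ fInv 2 ⊗^ 8) ⊗ one
  ≈⟨ ⊗-cong ≈-refl (≈-trans (⊗-cong (f-⊗-fInv 1) (f-⊗-fInv 1)) (⊗-identityˡ one)) ⟨
    phi ⊗ (f 4 ⊗^ 4 ⊗ fInv 2 ⊗^ 8) ⊗ ((f 1 ⊗ fInv 1) ⊗ (f 1 ⊗ fInv 1))
  ≈⟨ regroup₁ phi (f 1) (f 4) (fInv 1) (fInv 2) ⟩
    phi ⊗ (f 1 ⊗ f 1) ⊗ (f 4 ⊗ f 4) ⊗ (f 4 ⊗^ 2 ⊗ fInv 1 ⊗^ 2 ⊗ fInv 2 ⊗^ 8)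
  ≈⟨ ⊗-cong phi-product ≈-refl ⟩
    f 2 ⊗ f 2 ⊗ (f 2 ⊗ f 2 ⊗ f 2) ⊗ (f 4 ⊗^ 2 ⊗ fInv 1 ⊗^ 2 ⊗ fInv 2 ⊗^ 8)
  ≈⟨ regroup₂ (f 2) (f 4) (fInv 1) (fInv 2) ⟩
    (f 2 ⊗ fInv 2) ⊗^ 5 ⊗ G 0
  ≈⟨ ⊗-cong (≈-trans (⊗^-cong 5 (f-⊗-fInv 2)) (one-⊗^ 5)) ≈-refl ⟩
    one ⊗ G 0
  ≈⟨ ⊗-identityˡ (G 0) ⟩
    G 0
  ∎)
  where
  open ≈-Reasoning
  regroup₁ : ∀ ph f₁ f₄ i₁ i₂ →
    ph ⊗ (f₄ ⊗^ 4 ⊗ i₂ ⊗^ 8) ⊗ ((f₁ ⊗ i₁) ⊗ (f₁ ⊗ i₁))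
      ≈ ph ⊗ (f₁ ⊗ f₁) ⊗ (f₄ ⊗ f₄) ⊗ (f₄ ⊗^ 2 ⊗ i₁ ⊗^ 2 ⊗ i₂ ⊗^ 8)
  regroup₁ = solveˢ 5 (λ ph f₁ f₄ i₁ i₂ →
      ph :* (f₄ :^ 4 :* i₂ :^ 8) :* ((f₁ :* i₁) :* (f₁ :* i₁))
    := ph :* (f₁ :* f₁) :* (f₄ :* f₄) :* (f₄ :^ 2 :* i₁ :^ 2 :* i₂ :^ 8)) ≈-refl
  regroup₂ : ∀ f₂ f₄ i₁ i₂ →
    f₂ ⊗ f₂ ⊗ (f₂ ⊗ f₂ ⊗ f₂) ⊗ (f₄ ⊗^ 2 ⊗ i₁ ⊗^ 2 ⊗ i₂ ⊗^ 8)
      ≈ (f₂ ⊗ i₂) ⊗^ 5 ⊗ (f₄ ⊗^ 2 ⊗ (i₁ ⊗^ 2 ⊗ i₂ ⊗^ 3))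
  regroup₂ = solveˢ 4 (λ f₂ f₄ i₁ i₂ →
      f₂ :* f₂ :* (f₂ :* f₂ :* f₂) :* (f₄ :^ 2 :* i₁ :^ 2 :* i₂ :^ 8)
    := (f₂ :* i₂) :^ 5 :* (f₄ :^ 2 :* (i₁ :^ 2 :* i₂ :^ 3))) ≈-refl

Odd : ℕ → Set
Odd N = ∃ λ k → N ≡ suc (2 * k)

parity : ∀ i → (∃ λ a → i ≡ 2 * a) ⊎ Odd i
parity zero    = inj₁ (0 , refl)
parity (suc i) with parity i
... | inj₁ (a , i≡2a)   = inj₂ (a , cong suc i≡2a)
... | inj₂ (a , i≡1+2a) = inj₁ (suc a , trans (cong suc i≡1+2a) (solve (a ∷ [])))

Even : Series → Set
Even X = ∀ k → X (suc (2 * k)) ≡ + 0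

Even-⊗ : ∀ {a b} → Even a → Even b → Even (a ⊗ b)
Even-⊗ {a} {b} a-even b-even k = trans (⊗-at a b _) (sumTo-zero _ term)
  where
  term : ∀ i → i ≤ suc (2 * k) → a i *ℤ b (suc (2 * k) ∸ i) ≡ + 0
  term i i≤ with parity i
  ... | inj₂ (a′ , refl) = cong (_*ℤ b _) (a-even a′)
  ... | inj₁ (a′ , refl) = trans (cong (a (2 * a′) *ℤ_) (trans (cong b odd-rest) (b-even (k ∸ a′))))
                                 (ℤP.*-zeroʳ (a (2 * a′)))
    where
    2a′≤2k : 2 * a′ ≤ 2 * k
    2a′≤2k = ℕP.≤-pred (ℕP.≤∧≢⇒< i≤ (λ 2a′≡1+2k → ℕP.even≢odd a′ k 2a′≡1+2k))
    odd-rest : suc (2 * k) ∸ 2 * a′ ≡ suc (2 * (k ∸ a′))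
    odd-rest = trans (ℕP.+-∸-assoc 1 2a′≤2k) (cong suc (sym (ℕP.*-distribˡ-∸ 2 k a′)))

Even-one : Even one
Even-one k = refl

Even-∏ : ∀ K {F} → (∀ k → Even (F (suc k))) → Even (∏ K F)
Even-∏ zero    F-even = Even-one
Even-∏ (suc K) F-even = Even-⊗ (F-even K) (Even-∏ K F-even)

Even-⊗^ : ∀ {a} k → Even a → Even (a ⊗^ k)
Even-⊗^ zero    a-even = Even-one
Even-⊗^ (suc k) a-even = Even-⊗ a-even (Even-⊗^ k a-even)

Even-prod∞ : ∀ {F} → (∀ k → Even (F (suc k))) → Even (prod∞ F)
Even-prod∞ {F} F-even k = trans (at (prodTo≈∏ (suc (2 * k)) F) _) (Even-∏ (suc (2 * k)) F-even k)

Even-oneMinus : ∀ d → Even (oneMinus (2 * d))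
Even-oneMinus d k = cong ([ suc (2 * k) ℕ.≟ 0 ] +ℤ_) (cong -_ ([no] (suc (2 * k) ℕ.≟ 2 * d) (ℕP.even≢odd d k ∘ sym)))

2∤odd : ∀ k → ¬ 2 ∣ suc (2 * k)
2∤odd k (ℕ∣.divides e eq) = ℕP.even≢odd e k (sym (trans eq (ℕP.*-comm e 2)))

Even-geom : ∀ d → Even (geom (2 * d))
Even-geom d k = [no] (2 * d ∣? suc (2 * k)) (2∤odd k ∘ ℕ∣.∣-trans (ℕ∣.m∣m*n d))

Even-f₄ : Even (f 4)
Even-f₄ = Even-prod∞ {λ k → oneMinus (4 * k)} λ k → subst (Even ∘ oneMinus) (sym (ℕP.*-assoc 2 2 (suc k))) (Even-oneMinus (2 * suc k))

Even-fInv₂ : Even (fInv 2)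
Even-fInv₂ = Even-prod∞ {λ k → geom (2 * k)} λ k → Even-geom (suc k)

Even-quotient : ∀ {a M} .{{_ : ℕ.NonZero M}} → Even a → (a≡1 : a ≈ one [mod M ]) → Even (quotient a≡1)
Even-quotient {a} {M} a-even a≡1 k = ℤP.*-cancelˡ-≡ (+ M) _ (+ 0) (sym (begin
    + M *ℤ + 0                                 ≡⟨ ℤP.*-zeroʳ (+ M) ⟩
    + 0                                        ≡⟨ a-even k ⟨
    a (suc (2 * k))                            ≡⟨ ≈[mod]-at a≡1 (suc (2 * k)) ⟩
    + 0 +ℤ + M *ℤ quotient a≡1 (suc (2 * k))   ≡⟨ ℤP.+-identityˡ _ ⟩
    + M *ℤ quotient a≡1 (suc (2 * k))          ∎))
  where open ≡-Reasoning

-- the number of j ≥ 1 with j² = N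
squareCount : Series
squareCount N = ∑ N (λ j → q^ (j * j)) N

phi≈1+2squareCount : phi ≈ one ⊕ ι (+ 2) ⊗ squareCount
phi≈1+2squareCount = mk≈ λ N → begin
    phi N
  ≡⟨ ⊕-at one _ N ⟩
    one N +ℤ (ι (+ 2) ⊗ ∑ N (λ j → q^ (j * j))) N
  ≡⟨ cong (one N +ℤ_) (trans (ι-⊗ (+ 2) _ N) (sym (ι-⊗ (+ 2) squareCount N))) ⟩
    one N +ℤ (ι (+ 2) ⊗ squareCount) N
  ≡⟨ ⊕-at one _ N ⟨
    (one ⊕ ι (+ 2) ⊗ squareCount) N
  ∎
  where open ≡-Reasoning

-- ā₃ = φ · (1 + 8R) with R even, and φ = 1 + 2 squareCount
G₀-odd : ∀ {N} → Odd N → ∃ λ t → G 0 N ≡ + 2 *ℤ squareCount N +ℤ + 16 *ℤ t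
G₀-odd {N} (k , refl) = (squareCount ⊗ R) N , (begin
    G 0 N
  ≡⟨ at (≈-trans G₀≈phi⊗K (⊗-cong phi≈1+2squareCount K≈1+8R)) N ⟩
    ((one ⊕ ι (+ 2) ⊗ squareCount) ⊗ (one ⊕ ι (+ 8) ⊗ R)) N
  ≡⟨ at (expand squareCount R) N ⟩
    ((ι (+ 2) ⊗ squareCount ⊕ one) ⊕ ι (+ 8) ⊗ R ⊕ ι (+ 16) ⊗ (squareCount ⊗ R)) N
  ≡⟨ trans (⊕-at _ _ N) (cong₂ _+ℤ_ (trans (⊕-at _ _ N) (cong₂ _+ℤ_ (⊕-at _ _ N) (ι-⊗ (+ 8) R N))) (ι-⊗ (+ 16) _ N)) ⟩
    ((ι (+ 2) ⊗ squareCount) N +ℤ + 0 +ℤ + 8 *ℤ R N) +ℤ + 16 *ℤ (squareCount ⊗ R) N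
  ≡⟨ cong (λ x → (ι (+ 2) ⊗ squareCount) N +ℤ + 0 +ℤ + 8 *ℤ x +ℤ + 16 *ℤ (squareCount ⊗ R) N) (R-even k) ⟩
    ((ι (+ 2) ⊗ squareCount) N +ℤ + 0 +ℤ + 8 *ℤ + 0) +ℤ + 16 *ℤ (squareCount ⊗ R) N
  ≡⟨ cong (_+ℤ + 16 *ℤ (squareCount ⊗ R) N)
          (trans (ℤP.+-identityʳ _) (trans (ℤP.+-identityʳ _) (ι-⊗ (+ 2) squareCount N))) ⟩
    + 2 *ℤ squareCount N +ℤ + 16 *ℤ (squareCount ⊗ R) N
  ∎)
  where
  open ≡-Reasoning
  K≡1 : f 4 ⊗^ 4 ⊗ fInv 2 ⊗^ 8 ≈ one [mod 8 ]
  K≡1 = f₄^-fInv₂^-[mod] 2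
  R : Series
  R = quotient K≡1
  K≈1+8R : f 4 ⊗^ 4 ⊗ fInv 2 ⊗^ 8 ≈ one ⊕ ι (+ 8) ⊗ R
  K≈1+8R = ≈+multiple K≡1
  R-even : Even R
  R-even = Even-quotient (Even-⊗ (Even-⊗^ 4 Even-f₄) (Even-⊗^ 8 Even-fInv₂)) K≡1
  expand : ∀ S R → (one ⊕ ι (+ 2) ⊗ S) ⊗ (one ⊕ ι (+ 8) ⊗ R)
                   ≈ (ι (+ 2) ⊗ S ⊕ one) ⊕ ι (+ 8) ⊗ R ⊕ ι (+ 16) ⊗ (S ⊗ R)
  expand = solveˢ 2 (λ S R → (con (+ 1) :+ con (+ 2) :* S) :* (con (+ 1) :+ con (+ 8) :* R)
                           := (con (+ 2) :* S :+ con (+ 1)) :+ con (+ 8) :* R :+ con (+ 16) :* (S :* R)) ≈-refl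

abar-odd : ∀ m {N} → Odd N → abar (8 * m + 3) N ≡ + 2 *ℤ squareCount N [mod 16 ]
abar-odd m {N} N-odd with G₀-odd N-odd
... | t , G₀N≡ = ≡[mod]-intro 16 (t +ℤ s) (begin
    abar (8 * m + 3) N                                      ≡⟨ at (abarSeries≈G m) N ⟩
    G m N                                                   ≡⟨ ≈[mod]-at (G≈G₀ m) N ⟩
    G 0 N +ℤ + 16 *ℤ s                                      ≡⟨ cong (_+ℤ + 16 *ℤ s) G₀N≡ ⟩
    + 2 *ℤ squareCount N +ℤ + 16 *ℤ t +ℤ + 16 *ℤ s           ≡⟨ ℤP.+-assoc (+ 2 *ℤ squareCount N) _ _ ⟩
    + 2 *ℤ squareCount N +ℤ (+ 16 *ℤ t +ℤ + 16 *ℤ s)         ≡⟨ cong (+ 2 *ℤ squareCount N +ℤ_) (ℤP.*-distribˡ-+ (+ 16) t s) ⟨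
    + 2 *ℤ squareCount N +ℤ + 16 *ℤ (t +ℤ s)                 ∎)
  where
  open ≡-Reasoning
  s : ℤ
  s = quotient (G≈G₀ m) N

-- Squares and triangular numbers

sumTo-indicator-none : ∀ M {P : ℕ → Set} (P? : ∀ ν → Dec (P ν)) → (∀ ν → ν ≤ M → ¬ P ν) →
  sumTo M (λ ν → [ P? ν ]) ≡ + 0
sumTo-indicator-none M P? none = sumTo-zero M λ ν ν≤M → [no] (P? ν) (none ν ν≤M)

sumTo-indicator-unique : ∀ M {P : ℕ → Set} (P? : ∀ ν → Dec (P ν)) → (∀ {a b} → P a → P b → a ≡ b) →
  ∀ {ν} → ν ≤ M → P ν → sumTo M (λ i → [ P? i ]) ≡ + 1
sumTo-indicator-unique M P? unique {ν} ν≤M Pν = trans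
  (sumTo-cong M λ i _ → trans ([]-cong (P? i) (i ℕ.≟ ν) (λ Pi → unique Pi Pν) (λ { refl → Pν }))
                              (sym (ℤP.*-identityʳ _)))
  (sumTo-δ M ν (λ _ → + 1) ν≤M)

<-mono⇒injective : ∀ (g : ℕ → ℕ) → (∀ {a b} → a < b → g a < g b) → ∀ {a b} → g a ≡ g b → a ≡ b
<-mono⇒injective g g-mono {a} {b} ga≡gb with ℕP.<-cmp a b
... | tri< a<b _ _ = contradiction ga≡gb (ℕP.<⇒≢ (g-mono a<b))
... | tri≈ _ a≡b _ = a≡b
... | tri> _ _ b<a = contradiction (sym ga≡gb) (ℕP.<⇒≢ (g-mono b<a))

square-injective : ∀ {a b} → a * a ≡ b * b → a ≡ b
square-injective = <-mono⇒injective (λ a → a * a) (λ a<b → ℕP.*-mono-< a<b a<b)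

triangular-injective : ∀ {a b} → a * suc a ≡ b * suc b → a ≡ b
triangular-injective = <-mono⇒injective (λ a → a * suc a) (λ a<b → ℕP.*-mono-< a<b (s≤s a<b))

triangular-bound : ∀ {ν n} → ν * suc ν ≡ 2 * n → ν ≤ n
triangular-bound {zero}  _       = z≤n
triangular-bound {suc ν} {n} eq = ℕP.*-cancelˡ-≤ 2 (begin
    2 * suc ν         ≡⟨ ℕP.*-comm 2 (suc ν) ⟩
    suc ν * 2         ≤⟨ ℕP.*-monoʳ-≤ (suc ν) (s≤s (s≤s z≤n)) ⟩
    suc ν * suc (suc ν) ≡⟨ eq ⟩
    2 * n             ∎)
  where open ℕP.≤-Reasoning

psi-triangular : ∀ {n ν} → ν * suc ν ≡ 2 * n → psi n ≡ + 1
psi-triangular {n} {ν} eq = sumTo-indicator-unique n (λ ν → ν * suc ν ℕ.≟ 2 * n)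
  (λ ea eb → triangular-injective (trans ea (sym eb))) (triangular-bound {ν} eq) eq

psi-nontriangular : ∀ {n} → (∀ ν → ν * suc ν ≢ 2 * n) → psi n ≡ + 0
psi-nontriangular {n} none = sumTo-indicator-none n (λ ν → ν * suc ν ℕ.≟ 2 * n) (λ ν _ → none ν)

squareCount-suc : ∀ N → squareCount (suc N) ≡ sumTo (suc N) (λ j → [ suc N ℕ.≟ j * j ])
squareCount-suc N = trans (sym (ℤP.+-identityʳ _)) (∑-at (suc N) (λ j → q^ (j * j)) (suc N))

squareCount-square : ∀ {N v} → 1 ≤ v → v * v ≡ N → squareCount N ≡ + 1
squareCount-square {v = suc v} _ refl = trans (squareCount-suc (v + v * suc v))
  (sumTo-indicator-unique _ (λ j → _ ℕ.≟ j * j) (λ ea eb → square-injective (trans (sym ea) eb))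
                          (ℕP.m≤m*n (suc v) (suc v)) refl)

squareCount-nonsquare : ∀ {N} → (∀ v → v * v ≢ N) → squareCount N ≡ + 0
squareCount-nonsquare {zero}  none = contradiction refl (none 0)
squareCount-nonsquare {suc N} none = trans (squareCount-suc N)
  (sumTo-indicator-none (suc N) (λ j → suc N ℕ.≟ j * j) (λ v _ → none v ∘ sym))

Odd-* : ∀ {a b} → Odd a → Odd b → Odd (a * b)
Odd-* (x , refl) (y , refl) = x + y + 2 * x * y , solve (x ∷ y ∷ [])

Odd-^ : ∀ {a} e → Odd a → Odd (a ^ e)
Odd-^ zero    _     = 0 , refl
Odd-^ (suc e) a-odd = Odd-* a-odd (Odd-^ e a-odd)

odd-prime : ∀ {p} → Prime p → 3 ≤ p → Odd p
odd-prime {p} p-prime 3≤p with parity p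
... | inj₂ p-odd    = p-odd
... | inj₁ (a , p≡2a) with prime⇒irreducible p-prime (ℕ∣.divides a (trans p≡2a (ℕP.*-comm 2 a)))
...   | inj₁ ()
...   | inj₂ 2≡p = contradiction (subst (3 ≤_) (sym 2≡p) 3≤p) λ { (s≤s (s≤s ())) }

private
  p²u²≡[up]² : ∀ p u → p * p * (u * u) ≡ u * p * (u * p)
  p²u²≡[up]² = solve-∀

  p[u²p]≡[up]² : ∀ p u → p * (u * u * p) ≡ u * p * (u * p)
  p[u²p]≡[up]² = solve-∀

  p[p²Aw]≡p²[p[Aw]] : ∀ p A w → p * (p * p * A * w) ≡ p * p * (p * (A * w))
  p[p²Aw]≡p²[p[Aw]] = solve-∀

module _ {p : ℕ} (p-prime : Prime p) where

  private instance
    p≢0 : ℕ.NonZero p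
    p≢0 = prime⇒nonZero p-prime

  p∣²⇒p∣ : ∀ {v} → p ∣ v * v → p ∣ v
  p∣²⇒p∣ {v} p∣v² = reduce (euclidsLemma v v p-prime p∣v²)

  strip-p² : ∀ v X → v * v ≡ p * p * X → ∃ λ u → u * u ≡ X
  strip-p² v X eq = strip (p∣²⇒p∣ {v} (ℕ∣.divides (p * X) (trans eq (solve (p ∷ X ∷ [])))))
    where
    strip : p ∣ v → ∃ λ u → u * u ≡ X
    strip (ℕ∣.divides u refl) = u , ℕP.*-cancelˡ-≡ (u * u) X (p * p) {{ℕP.m*n≢0 p p}} (trans (p²u²≡[up]² p u) eq)

  square-root-of-p²ᵅ-multiple : ∀ α v w → v * v ≡ (p * p) ^ α * w → ∃ λ u → u * u ≡ w
  square-root-of-p²ᵅ-multiple zero    v w eq = v , trans eq (ℕP.+-identityʳ w)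
  square-root-of-p²ᵅ-multiple (suc α) v w eq =
    let u , u²≡ = strip-p² v ((p * p) ^ α * w) (trans eq (ℕP.*-assoc (p * p) ((p * p) ^ α) w))
    in square-root-of-p²ᵅ-multiple α u w u²≡

  p∣root : ∀ {v w} → v * v ≡ p * w → p ∣ v → p ∣ w
  p∣root {w = w} eq (ℕ∣.divides u refl) =
    ℕ∣.divides (u * u) (ℕP.*-cancelˡ-≡ w _ p (sym (trans (p[u²p]≡[up]² p u) eq)))

  p-multiple-nonsquare : ∀ {w} → ¬ p ∣ w → ∀ v → v * v ≢ p * w
  p-multiple-nonsquare {w} p∤w v eq = p∤w (p∣root eq (p∣²⇒p∣ {v} (ℕ∣.divides w (trans eq (ℕP.*-comm p w)))))

  p²ᵅ⁺¹-multiple-nonsquare : ∀ {w} → ¬ p ∣ w → ∀ α v → v * v ≢ p * ((p * p) ^ α * w)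
  p²ᵅ⁺¹-multiple-nonsquare {w} p∤w zero v eq =
    p-multiple-nonsquare p∤w v (trans eq (cong (p *_) (ℕP.+-identityʳ w)))
  p²ᵅ⁺¹-multiple-nonsquare {w} p∤w (suc α) v eq =
    let u , u²≡ = strip-p² v (p * ((p * p) ^ α * w)) (trans eq (p[p²Aw]≡p²[p[Aw]] p ((p * p) ^ α) w))
    in p²ᵅ⁺¹-multiple-nonsquare p∤w α u u²≡

odd-square-root : ∀ {n u} → u * u ≡ 8 * n + 1 → ∃ λ ν → ν * suc ν ≡ 2 * n
odd-square-root {n} {u} eq with parity u
... | inj₁ (a , refl) = contradiction (trans square≡ (trans eq 8n+1≡)) (ℕP.even≢odd (2 * (a * a)) (4 * n))
  where
  square≡ : 2 * (2 * (a * a)) ≡ 2 * a * (2 * a)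
  square≡ = solve (a ∷ [])
  8n+1≡ : 8 * n + 1 ≡ suc (2 * (4 * n))
  8n+1≡ = solve (n ∷ [])
... | inj₂ (b , refl) = b , ℕP.*-cancelˡ-≡ (b * suc b) (2 * n) 4 (ℕP.+-cancelʳ-≡ 1 _ _ (trans square≡ (trans eq 8n+1≡)))
  where
  square≡ : 4 * (b * suc b) + 1 ≡ suc (2 * b) * suc (2 * b)
  square≡ = solve (b ∷ [])
  8n+1≡ : 8 * n + 1 ≡ 4 * (2 * n) + 1
  8n+1≡ = solve (n ∷ [])

private
  [s[1+2ν]]²≡s²[4ν[1+ν]+1] : ∀ s ν → s * suc (2 * ν) * (s * suc (2 * ν)) ≡ s * s * (4 * (ν * suc ν) + 1)
  [s[1+2ν]]²≡s²[4ν[1+ν]+1] = solve-∀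

p²ᵅ≡[p*p]^α : ∀ p α → p ^ (2 * α) ≡ (p * p) ^ α
p²ᵅ≡[p*p]^α p α = trans (sym (ℕP.^-*-assoc p 2 α)) (cong (λ x → (p * x) ^ α) (ℕP.*-identityʳ p))

squareCount-p²ᵅ[8n+1] : ∀ {p} → Prime p → ∀ α n → squareCount (p ^ (2 * α) * (8 * n + 1)) ≡ psi n
squareCount-p²ᵅ[8n+1] {p} p-prime α n with ℕP.anyUpTo? (λ ν → ν * suc ν ℕ.≟ 2 * n) (suc n)
... | yes (ν , _ , triangular) = trans (squareCount-square 1≤v v²≡N) (sym (psi-triangular {n} {ν} triangular))
  where
  v : ℕ
  v = p ^ α * suc (2 * ν)
  1≤v : 1 ≤ v
  1≤v = ℕP.*-mono-≤ (ℕP.m^n>0 p {{prime⇒nonZero p-prime}} α) (s≤s z≤n)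
  v²≡N : v * v ≡ p ^ (2 * α) * (8 * n + 1)
  v²≡N = begin
    v * v                                     ≡⟨ [s[1+2ν]]²≡s²[4ν[1+ν]+1] (p ^ α) ν ⟩
    p ^ α * p ^ α * (4 * (ν * suc ν) + 1)     ≡⟨ cong₂ (λ x y → x * (4 * y + 1)) (sym (ℕP.^-distribˡ-+-* p α α)) triangular ⟩
    p ^ (α + α) * (4 * (2 * n) + 1)           ≡⟨ cong₂ (λ x y → p ^ x * y) α+α≡2α 8n+1≡ ⟩
    p ^ (2 * α) * (8 * n + 1)                 ∎
    where
    open ≡-Reasoning
    α+α≡2α : α + α ≡ 2 * α
    α+α≡2α = solve (α ∷ [])
    8n+1≡ : 4 * (2 * n) + 1 ≡ 8 * n + 1
    8n+1≡ = solve (n ∷ [])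
... | no ¬triangular = trans (squareCount-nonsquare nonsquare) (sym (psi-nontriangular {n} nontriangular))
  where
  nontriangular : ∀ ν → ν * suc ν ≢ 2 * n
  nontriangular ν eq = ¬triangular (ν , s≤s (triangular-bound {ν} eq) , eq)
  nonsquare : ∀ v → v * v ≢ p ^ (2 * α) * (8 * n + 1)
  nonsquare v eq =
    let u , u²≡ = square-root-of-p²ᵅ-multiple p-prime α v (8 * n + 1) (trans eq (cong (_* (8 * n + 1)) (p²ᵅ≡[p*p]^α p α)))
        ν , eq′ = odd-square-root {n} {u} u²≡
    in nontriangular ν eq′

squareCount-p²ᵅ⁺¹w : ∀ {p w} → Prime p → ¬ p ∣ w → ∀ α → squareCount (p ^ (2 * α + 1) * w) ≡ + 0
squareCount-p²ᵅ⁺¹w {p} {w} p-prime p∤w α = squareCount-nonsquare λ v eq →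
  p²ᵅ⁺¹-multiple-nonsquare p-prime p∤w α v (trans eq N≡)
  where
  N≡ : p ^ (2 * α + 1) * w ≡ p * ((p * p) ^ α * w)
  N≡ = begin
    p ^ (2 * α + 1) * w      ≡⟨ cong (λ e → p ^ e * w) (ℕP.+-comm (2 * α) 1) ⟩
    p * p ^ (2 * α) * w      ≡⟨ cong (λ x → p * x * w) (p²ᵅ≡[p*p]^α p α) ⟩
    p * (p * p) ^ α * w      ≡⟨ ℕP.*-assoc p _ w ⟩
    p * ((p * p) ^ α * w)    ∎
    where open ≡-Reasoning

Odd-8*+ : ∀ x {a} → Odd a → Odd (8 * x + a)
Odd-8*+ x (b , refl) = 4 * x + b , solve (x ∷ b ∷ [])

≥3∤2 : ∀ {p} → 3 ≤ p → ¬ p ∣ 2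
≥3∤2 3≤p p∣2 = ℕP.<⇒≱ 3≤p (ℕ∣.∣⇒≤ p∣2)

prime≥3∤8 : ∀ {p} → Prime p → 3 ≤ p → ¬ p ∣ 8
prime≥3∤8 p-prime 3≤p p∣8 with euclidsLemma 2 4 p-prime p∣8
... | inj₁ p∣2 = ≥3∤2 3≤p p∣2
... | inj₂ p∣4 = ≥3∤2 3≤p (reduce (euclidsLemma 2 2 p-prime p∣4))

prime∤8[pn+r]+p : ∀ {p} → Prime p → 3 ≤ p → ∀ n {r} → 1 ≤ r → r ≤ p ∸ 1 → ¬ p ∣ 8 * (p * n + r) + p
prime∤8[pn+r]+p {p@(suc q)} p-prime 3≤p n {r} 1≤r r≤q p∣w
  with euclidsLemma 8 (p * n + r) p-prime (ℕ∣.∣m+n∣m⇒∣n (subst (p ∣_) (ℕP.+-comm _ p) p∣w) ℕ∣.∣-refl)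
... | inj₁ p∣8     = prime≥3∤8 p-prime 3≤p p∣8
... | inj₂ p∣pn+r = ℕP.<⇒≱ (s≤s r≤q) (ℕ∣.∣⇒≤ {{ℕ.>-nonZero 1≤r}} (ℕ∣.∣m+n∣m⇒∣n p∣pn+r (ℕ∣.m∣m*n n)))

private
  8Pn+P≡P[8n+1] : ∀ P n → 8 * P * n + P ≡ P * (8 * n + 1)
  8Pn+P≡P[8n+1] = solve-∀

  8Xy+pX≡X[8y+p] : ∀ X y p → 8 * X * y + p * X ≡ X * (8 * y + p)
  8Xy+pX≡X[8y+p] = solve-∀

mainTheorem6 : (p r : ℕ) → Prime p → 3 ≤ p → 1 ≤ r → r ≤ p ∸ 1 →
    (α m : ℕ) →
      ((n : ℕ) → abar (8 * m + 3) (8 * p ^ (2 * α) * n + p ^ (2 * α)) ≡ (+ 2) *ℤ psi n [mod 16 ])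
      × ((n : ℕ) → abar (8 * m + 3) (8 * p ^ (2 * α + 1) * (p * n + r) + p ^ (2 * α + 2)) ≡ + 0 [mod 16 ])
mainTheorem6 p r p-prime 3≤p 1≤r r≤p∸1 α m = part₁ , part₂
  where
  p-odd : Odd p
  p-odd = odd-prime p-prime 3≤p
  part₁ : ∀ n → abar (8 * m + 3) (8 * p ^ (2 * α) * n + p ^ (2 * α)) ≡ + 2 *ℤ psi n [mod 16 ]
  part₁ n rewrite 8Pn+P≡P[8n+1] (p ^ (2 * α)) n =
    subst (λ x → abar (8 * m + 3) (p ^ (2 * α) * (8 * n + 1)) ≡ + 2 *ℤ x [mod 16 ])
          (squareCount-p²ᵅ[8n+1] p-prime α n)
          (abar-odd m (Odd-* (Odd-^ (2 * α) p-odd) (Odd-8*+ n (0 , refl))))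
  part₂ : ∀ n → abar (8 * m + 3) (8 * p ^ (2 * α + 1) * (p * n + r) + p ^ (2 * α + 2)) ≡ + 0 [mod 16 ]
  part₂ n rewrite ℕP.+-suc (2 * α) 1 | 8Xy+pX≡X[8y+p] (p ^ (2 * α + 1)) (p * n + r) p =
    subst (λ x → abar (8 * m + 3) (p ^ (2 * α + 1) * (8 * (p * n + r) + p)) ≡ + 2 *ℤ x [mod 16 ])
          (squareCount-p²ᵅ⁺¹w p-prime (prime∤8[pn+r]+p p-prime 3≤p n 1≤r r≤p∸1) α)
          (abar-odd m (Odd-* (Odd-^ (2 * α + 1) p-odd) (Odd-8*+ (p * n + r) p-odd)))
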